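{- Let $k\ge1$ be an integer and define \[ C_1=\sum_{j=0}^{\infty}\frac{q^{8kj+8k+4j^2+6j+2}}{(-q^{2k+2};q^2)_{2j+2}}\left(1-q^{4k+4j+4}\right)\sum_{i=1}^{2j+1}\frac{q^{2i}}{1+q^{2i+2k}}, \] \[ C_2=\sum_{j=0}^{\infty}\frac{q^{8kj+8k+4j^2+6j+2}}{(-q^{2k+2};q^2)_{2j+2}}\,q^{2k+4j+4}\sum_{i=2}^{2j+1}\frac{q^{2i}}{1+q^{2i+2k}}, \] \[ C_3=\sum_{j=0}^{\infty}\frac{q^{8kj+8k+4j^2+6j+2}}{(-q^{2k+2};q^2)_{2j+2}}\,q^{2k+4j+4}\left(\frac{q^{2}}{1+q^{2k+2}}-\frac{q^{2k+4j+4}}{1+q^{2k+4j+4}}\right), \] \[ C_4=\sum_{n=0}^{\infty}\frac{(-1)^n(2n+2)q^{4kn+2k+n^2+n}}{(-q^{2k+2};q^2)_n}. \] Then each of the power series $\dfrac{C_m}{(q^2;q^2)_{\infty}^{3}(q^2;q^4)_{\infty}^{2}}$, $m=1,2,3,4$, has non-negative coefficients.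
   Context: $(x;q)_n=\prod_{j=1}^{n}(1-xq^{j-1})$ (with $(x;q)_0=1$), $(x;q)_\infty=\prod_{j\ge1}(1-xq^{j-1})$. -}

module Defs where

open import Data.Nat as ℕ using (ℕ; zero; suc; _∸_; _≡ᵇ_)
open import Data.Integer as ℤ using (ℤ; +_; -_; 0ℤ; 1ℤ; -1ℤ)
open import Data.Bool using (if_then_else_)

-- Formal power series in q with integer coefficients: n ↦ coefficient of q^n.
Series : Set
Series = ℕ → ℤ

sumTo : ℕ → (ℕ → ℤ) → ℤ
sumTo zero    f = f 0
sumTo (suc n) f = sumTo n f ℤ.+ f (suc n)

qpow : ℕ → Series
qpow m n = if n ≡ᵇ m then 1ℤ else 0ℤ

oneS : Series
oneS = qpow 0

_⊕_ : Series → Series → Series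
(a ⊕ b) n = a n ℤ.+ b n

_⊖_ : Series → Series → Series
(a ⊖ b) n = a n ℤ.- b n

_·_ : ℤ → Series → Series
(c · a) n = c ℤ.* a n

_⊗_ : Series → Series → Series
(a ⊗ b) n = sumTo n (λ i → a i ℤ.* b (n ∸ i))

infixl 6 _⊕_ _⊖_
infixl 7 _⊗_ _·_

powS : Series → ℕ → Series
powS a zero    = oneS
powS a (suc j) = a ⊗ powS a j

-- Inverse of a series with constant term 1:  1/a = Σ_{j≥0} (1 - a)^j
-- ((1-a)^j has valuation ≥ j, so the coefficient of q^n only needs j ≤ n).
invS : Series → Series
invS a n = sumTo n (λ j → powS (oneS ⊖ a) j n)

-- a / b  for b with constant term 1
_⊘_ : Series → Series → Series
a ⊘ b = a ⊗ invS b

infixl 7 _⊘_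

finSum : ℕ → (ℕ → Series) → Series
finSum zero    f = λ _ → 0ℤ
finSum (suc n) f = finSum n f ⊕ f n

finProd : ℕ → (ℕ → Series) → Series
finProd zero    f = oneS
finProd (suc n) f = finProd n f ⊗ f n

-- Infinite sum Σ_{j≥0} f j, valid when f j has valuation ≥ j
-- (true for all sums used below): coefficient of q^n is Σ_{j≤n} [q^n] f j.
infSum : (ℕ → Series) → Series
infSum f n = sumTo n (λ j → f j n)

-- (c q^a ; q^b)_n = Π_{j=1}^{n} (1 - c q^{a + b(j-1)})
poch : ℤ → ℕ → ℕ → ℕ → Series
poch c a b n = finProd n (λ j → oneS ⊖ c · qpow (a ℕ.+ b ℕ.* j))

-- (c q^a ; q^b)_∞, valid for a ≥ 1, b ≥ 1 (each factor 1 - c q^{a+bj} differs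
-- from 1 only in degrees ≥ j+1, so coefficient n is determined by the first n+1 factors).
poch∞ : ℤ → ℕ → ℕ → Series
poch∞ c a b n = poch c a b (suc n) n

T : ℕ → ℕ → Series
T k j = qpow (8 ℕ.* k ℕ.* j ℕ.+ 8 ℕ.* k ℕ.+ 4 ℕ.* j ℕ.* j ℕ.+ 6 ℕ.* j ℕ.+ 2)
        ⊘ poch -1ℤ (2 ℕ.* k ℕ.+ 2) 2 (2 ℕ.* j ℕ.+ 2)

g : ℕ → ℕ → Series
g k i = qpow (2 ℕ.* i) ⊘ (oneS ⊕ qpow (2 ℕ.* i ℕ.+ 2 ℕ.* k))

C1 : ℕ → Series
C1 k = infSum (λ j → T k j ⊗ (oneS ⊖ qpow (4 ℕ.* k ℕ.+ 4 ℕ.* j ℕ.+ 4))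
                      ⊗ finSum (2 ℕ.* j ℕ.+ 1) (λ i → g k (i ℕ.+ 1)))   -- Σ_{i=1}^{2j+1}

C2 : ℕ → Series
C2 k = infSum (λ j → T k j ⊗ qpow (2 ℕ.* k ℕ.+ 4 ℕ.* j ℕ.+ 4)
                      ⊗ finSum (2 ℕ.* j) (λ i → g k (i ℕ.+ 2)))         -- Σ_{i=2}^{2j+1}

C3 : ℕ → Series
C3 k = infSum (λ j → T k j ⊗ qpow (2 ℕ.* k ℕ.+ 4 ℕ.* j ℕ.+ 4)
                      ⊗ (qpow 2 ⊘ (oneS ⊕ qpow (2 ℕ.* k ℕ.+ 2))
                         ⊖ qpow (2 ℕ.* k ℕ.+ 4 ℕ.* j ℕ.+ 4) ⊘ (oneS ⊕ qpow (2 ℕ.* k ℕ.+ 4 ℕ.* j ℕ.+ 4))))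

C4 : ℕ → Series
C4 k = infSum (λ n → ((-1ℤ ℤ.^ n) ℤ.* (+ (2 ℕ.* n ℕ.+ 2)))
                       · qpow (4 ℕ.* k ℕ.* n ℕ.+ 2 ℕ.* k ℕ.+ n ℕ.* n ℕ.+ n)
                     ⊘ poch -1ℤ (2 ℕ.* k ℕ.+ 2) 2 n)

D : Series
D = powS (poch∞ 1ℤ 2 2) 3 ⊗ powS (poch∞ 1ℤ 2 4) 2

NonNegCoeffs : Series → Set
NonNegCoeffs a = ∀ n → 0ℤ ℤ.≤ a n

-- Write 1/(−q^{2k+2}; q²)_L = (q^{2k+2}; q²)_L / (q^{4k+4}; q⁴)_L and
-- 1/(1 + q^m) = (1 − q^m)/(1 − q^{2m}). Then each summand of C₁, C₂ and C₃, and each pair of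
-- consecutive summands n = 2j, 2j + 1 of C₄, becomes a series with non-negative coefficients times
-- at most three numerator products, each a product of factors 1 − q^{2+2t} with distinct t. The
-- denominator D contains three copies of (q²; q²)_∞ = ∏_t (1 − q^{2+2t}), so each numerator product
-- cancels against its own copy, and what remains is a product of series with non-negative
-- coefficients.
-- For C₃ the difference of the two fractions is (1 − q²)(1 − q^{2k+2})(1 − q^{2k+4j+4}) times a
-- non-negative series; the first two factors are distinct because k ≥ 1. For C₄ the pair is a power
-- of q over (−q^{2k+2}; q²)_{2j+1} times (4j + 2)(1 − q^{4k+4j+2}) + 4j q^e + 2q^e(1 − q^{2k}), where
-- e = 2k + 4j + 2.
-- Infinite sums and products are handled through truncations: only finitely many terms affect a
-- given coefficient.

module Submission where

open import Defs
open import Algebra.Bundles using (CommutativeRing)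
open import Algebra.Solver.Ring.AlmostCommutativeRing
  using (fromCommutativeRing; _-Raw-AlmostCommutative⟶_)
open import Data.Bool.Base using (true; false; if_then_else_)
open import Data.Integer.Base as ℤ using (ℤ; +_; 0ℤ; 1ℤ; -1ℤ; +≤+)
import Data.Integer.Properties as ℤ
import Data.Integer.Tactic.RingSolver as ℤ-Solver
open import Data.List.Base using (_∷_; [])
open import Data.Maybe.Base using (Maybe; just; nothing)
open import Data.Nat.Base as ℕ using (ℕ; zero; suc; _∸_; _≤_; _<_; _⊔_; z≤n; s≤s)
import Data.Nat.Properties as ℕ
import Data.Nat.Tactic.RingSolver as ℕ-Solver
open import Data.Product.Base using (Σ-syntax; _×_; _,_)
open import Data.Sum.Base using (inj₁; inj₂)
open import Function.Base using (_∘_)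
open import Level using (0ℓ)
open import Relation.Binary.PropositionalEquality
open import Relation.Nullary.Decidable.Core using (yes; no)
import Relation.Binary.Reasoning.Setoid as SetoidReasoning

-- Power series

sumTo-cong : ∀ n {f g : ℕ → ℤ} → (∀ i → i ≤ n → f i ≡ g i) → sumTo n f ≡ sumTo n g
sumTo-cong zero    f≗g = f≗g 0 z≤n
sumTo-cong (suc n) f≗g =
  cong₂ ℤ._+_ (sumTo-cong n (λ i i≤n → f≗g i (ℕ.m≤n⇒m≤1+n i≤n))) (f≗g (suc n) ℕ.≤-refl)

sumTo-unfoldˡ : ∀ n (f : ℕ → ℤ) → sumTo (suc n) f ≡ f 0 ℤ.+ sumTo n (f ∘ suc)
sumTo-unfoldˡ zero    f = refl
sumTo-unfoldˡ (suc n) f = begin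
  sumTo (suc n) f ℤ.+ f (2 ℕ.+ n)             ≡⟨ cong (ℤ._+ f (2 ℕ.+ n)) (sumTo-unfoldˡ n f) ⟩
  (f 0 ℤ.+ sumTo n (f ∘ suc)) ℤ.+ f (2 ℕ.+ n) ≡⟨ ℤ.+-assoc (f 0) _ _ ⟩
  f 0 ℤ.+ sumTo (suc n) (f ∘ suc)             ∎
  where open ≡-Reasoning

sumTo-+ : ∀ n (f g : ℕ → ℤ) → sumTo n (λ i → f i ℤ.+ g i) ≡ sumTo n f ℤ.+ sumTo n g
sumTo-+ zero    f g = refl
sumTo-+ (suc n) f g =
  trans (cong (ℤ._+ (f (suc n) ℤ.+ g (suc n))) (sumTo-+ n f g))
        (interchange (sumTo n f) (sumTo n g) (f (suc n)) (g (suc n)))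
  where
  interchange : ∀ a b c d → (a ℤ.+ b) ℤ.+ (c ℤ.+ d) ≡ (a ℤ.+ c) ℤ.+ (b ℤ.+ d)
  interchange = ℤ-Solver.solve-∀

sumTo-*ˡ : ∀ n c (f : ℕ → ℤ) → sumTo n (λ i → c ℤ.* f i) ≡ c ℤ.* sumTo n f
sumTo-*ˡ zero    c f = refl
sumTo-*ˡ (suc n) c f =
  trans (cong (ℤ._+ c ℤ.* f (suc n)) (sumTo-*ˡ n c f)) (sym (ℤ.*-distribˡ-+ c _ _))

sumTo-zero : ∀ n (f : ℕ → ℤ) → (∀ i → i ≤ n → f i ≡ 0ℤ) → sumTo n f ≡ 0ℤ
sumTo-zero n f f≗0 = trans (sumTo-cong n f≗0) (sumTo-const0 n)
  where
  sumTo-const0 : ∀ n → sumTo n (λ _ → 0ℤ) ≡ 0ℤ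
  sumTo-const0 zero    = refl
  sumTo-const0 (suc n) = cong (ℤ._+ 0ℤ) (sumTo-const0 n)

sumTo-nonNeg : ∀ n (f : ℕ → ℤ) → (∀ i → i ≤ n → 0ℤ ℤ.≤ f i) → 0ℤ ℤ.≤ sumTo n f
sumTo-nonNeg zero    f f≥0 = f≥0 0 z≤n
sumTo-nonNeg (suc n) f f≥0 =
  ℤ.+-mono-≤ (sumTo-nonNeg n f (λ i i≤n → f≥0 i (ℕ.m≤n⇒m≤1+n i≤n))) (f≥0 (suc n) ℕ.≤-refl)

sumTo-reverse : ∀ n (f : ℕ → ℤ) → sumTo n f ≡ sumTo n (λ i → f (n ∸ i))
sumTo-reverse zero    f = refl
sumTo-reverse (suc n) f = begin
  sumTo n f ℤ.+ f (suc n)                    ≡⟨ ℤ.+-comm (sumTo n f) _ ⟩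
  f (suc n) ℤ.+ sumTo n f                    ≡⟨ cong (λ x → f (suc n) ℤ.+ x) (sumTo-reverse n f) ⟩
  f (suc n) ℤ.+ sumTo n (λ i → f (n ∸ i))    ≡⟨ sumTo-unfoldˡ n (λ i → f (suc n ∸ i)) ⟨
  sumTo (suc n) (λ i → f (suc n ∸ i))        ∎
  where open ≡-Reasoning

sumTo-extend : ∀ {m n} (f : ℕ → ℤ) → m ≤ n → (∀ i → m < i → f i ≡ 0ℤ) → sumTo n f ≡ sumTo m f
sumTo-extend {n = zero}  f z≤n tail≗0 = refl
sumTo-extend {m} {suc n} f m≤1+n tail≗0 with ℕ.m≤n⇒m<n∨m≡n m≤1+n
... | inj₂ refl = refl
... | inj₁ (s≤s m≤n) =
  trans (cong₂ ℤ._+_ (sumTo-extend f m≤n tail≗0) (tail≗0 (suc n) (s≤s m≤n))) (ℤ.+-identityʳ _)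

infix 4 _≋_
record _≋_ (a b : Series) : Set where
  constructor mk≋
  field at : ∀ n → a n ≡ b n
open _≋_

0S : Series
0S _ = 0ℤ

negS : Series → Series
negS a n = ℤ.- a n

shift : Series → Series
shift a n = a (suc n)

⊗-unfold : ∀ a b n → (a ⊗ b) (suc n) ≡ a 0 ℤ.* b (suc n) ℤ.+ (shift a ⊗ b) n
⊗-unfold a b n = sumTo-unfoldˡ n _

⊗-cong-≤ : ∀ n {a a′ b b′} → (∀ m → m ≤ n → a m ≡ a′ m) → (∀ m → m ≤ n → b m ≡ b′ m) →
           (a ⊗ b) n ≡ (a′ ⊗ b′) n
⊗-cong-≤ n a≗a′ b≗b′ =
  sumTo-cong n (λ i i≤n → cong₂ ℤ._*_ (a≗a′ i i≤n) (b≗b′ (n ∸ i) (ℕ.m∸n≤m n i)))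

⊗-congˡ-≤ : ∀ n a {b b′} → (∀ m → m ≤ n → b m ≡ b′ m) → (a ⊗ b) n ≡ (a ⊗ b′) n
⊗-congˡ-≤ n a = ⊗-cong-≤ n {a} {a} (λ _ _ → refl)

⊗-comm-at : ∀ a b n → (a ⊗ b) n ≡ (b ⊗ a) n
⊗-comm-at a b n = trans (sumTo-reverse n _) (sumTo-cong n λ i i≤n →
  trans (cong (λ m → a (n ∸ i) ℤ.* b m) (ℕ.m∸[m∸n]≡n i≤n)) (ℤ.*-comm (a (n ∸ i)) (b i)))

⊗-distribʳ-at : ∀ a b c n → ((a ⊕ b) ⊗ c) n ≡ (a ⊗ c) n ℤ.+ (b ⊗ c) n
⊗-distribʳ-at a b c n =
  trans (sumTo-cong n (λ i _ → ℤ.*-distribʳ-+ (c (n ∸ i)) (a i) (b i))) (sumTo-+ n _ _)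

·-⊗-at : ∀ k a c n → ((k · a) ⊗ c) n ≡ k ℤ.* (a ⊗ c) n
·-⊗-at k a c n = trans (sumTo-cong n (λ i _ → ℤ.*-assoc k (a i) (c (n ∸ i)))) (sumTo-*ˡ n k _)

⊗-zeroˡ-at : ∀ a n → (0S ⊗ a) n ≡ 0ℤ
⊗-zeroˡ-at a n = sumTo-zero n _ (λ i _ → ℤ.*-zeroˡ (a (n ∸ i)))

⊗-identityˡ-at : ∀ a n → (oneS ⊗ a) n ≡ a n
⊗-identityˡ-at a zero    = ℤ.*-identityˡ (a 0)
⊗-identityˡ-at a (suc n) = begin
  (oneS ⊗ a) (suc n)               ≡⟨ ⊗-unfold oneS a n ⟩
  1ℤ ℤ.* a (suc n) ℤ.+ (0S ⊗ a) n  ≡⟨ cong₂ ℤ._+_ (ℤ.*-identityˡ (a (suc n))) (⊗-zeroˡ-at a n) ⟩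
  a (suc n) ℤ.+ 0ℤ                 ≡⟨ ℤ.+-identityʳ (a (suc n)) ⟩
  a (suc n)                        ∎
  where open ≡-Reasoning

⊗-assoc-at : ∀ n a b c → ((a ⊗ b) ⊗ c) n ≡ (a ⊗ (b ⊗ c)) n
⊗-assoc-at zero    a b c = ℤ.*-assoc (a 0) (b 0) (c 0)
⊗-assoc-at (suc n) a b c = begin
  ((a ⊗ b) ⊗ c) (suc n)
    ≡⟨ ⊗-unfold (a ⊗ b) c n ⟩
  (a 0 ℤ.* b 0) ℤ.* c (suc n) ℤ.+ (shift (a ⊗ b) ⊗ c) n
    ≡⟨ cong (λ x → (a 0 ℤ.* b 0) ℤ.* c (suc n) ℤ.+ x) shift-⊗ ⟩
  (a 0 ℤ.* b 0) ℤ.* c (suc n) ℤ.+ (a 0 ℤ.* (shift b ⊗ c) n ℤ.+ (shift a ⊗ (b ⊗ c)) n)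
    ≡⟨ regroup (a 0) (b 0) (c (suc n)) _ _ ⟩
  a 0 ℤ.* (b 0 ℤ.* c (suc n) ℤ.+ (shift b ⊗ c) n) ℤ.+ (shift a ⊗ (b ⊗ c)) n
    ≡⟨ cong (λ x → a 0 ℤ.* x ℤ.+ (shift a ⊗ (b ⊗ c)) n) (⊗-unfold b c n) ⟨
  a 0 ℤ.* (b ⊗ c) (suc n) ℤ.+ (shift a ⊗ (b ⊗ c)) n
    ≡⟨ ⊗-unfold a (b ⊗ c) n ⟨
  (a ⊗ (b ⊗ c)) (suc n)
    ∎
  where
  open ≡-Reasoning
  regroup : ∀ x y z u v → (x ℤ.* y) ℤ.* z ℤ.+ (x ℤ.* u ℤ.+ v) ≡ x ℤ.* (y ℤ.* z ℤ.+ u) ℤ.+ v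
  regroup = ℤ-Solver.solve-∀
  shift-⊗ : (shift (a ⊗ b) ⊗ c) n ≡ a 0 ℤ.* (shift b ⊗ c) n ℤ.+ (shift a ⊗ (b ⊗ c)) n
  shift-⊗ = begin
    (shift (a ⊗ b) ⊗ c) n
      ≡⟨ ⊗-cong-≤ n {b = c} (λ m _ → ⊗-unfold a b m) (λ _ _ → refl) ⟩
    ((a 0 · shift b ⊕ shift a ⊗ b) ⊗ c) n
      ≡⟨ ⊗-distribʳ-at (a 0 · shift b) (shift a ⊗ b) c n ⟩
    (a 0 · shift b ⊗ c) n ℤ.+ ((shift a ⊗ b) ⊗ c) n
      ≡⟨ cong₂ ℤ._+_ (·-⊗-at (a 0) (shift b) c n) (⊗-assoc-at n (shift a) b c) ⟩
    a 0 ℤ.* (shift b ⊗ c) n ℤ.+ (shift a ⊗ (b ⊗ c)) n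
      ∎

≋-refl : ∀ {a} → a ≋ a
≋-refl = mk≋ (λ _ → refl)

≋-sym : ∀ {a b} → a ≋ b → b ≋ a
≋-sym a≋b = mk≋ (λ n → sym (at a≋b n))

≋-trans : ∀ {a b c} → a ≋ b → b ≋ c → a ≋ c
≋-trans a≋b b≋c = mk≋ (λ n → trans (at a≋b n) (at b≋c n))

≡⇒≋ : ∀ {a b} → a ≡ b → a ≋ b
≡⇒≋ refl = ≋-refl

seriesRing : CommutativeRing 0ℓ 0ℓ
seriesRing = record
  { Carrier = Series ; _≈_ = _≋_ ; _+_ = _⊕_ ; _*_ = _⊗_ ; -_ = negS ; 0# = 0S ; 1# = oneS
  ; isCommutativeRing = record
    { isRing = record
      { +-isAbelianGroup = record
        { isGroup = record
          { isMonoid = record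
            { isSemigroup = record
              { isMagma = record
                { isEquivalence = record { refl = ≋-refl ; sym = ≋-sym ; trans = ≋-trans }
                ; ∙-cong = λ p q → mk≋ (λ n → cong₂ ℤ._+_ (at p n) (at q n)) }
              ; assoc = λ a b c → mk≋ (λ n → ℤ.+-assoc (a n) (b n) (c n)) }
            ; identity = (λ a → mk≋ (λ n → ℤ.+-identityˡ (a n)))
                       , (λ a → mk≋ (λ n → ℤ.+-identityʳ (a n))) }
          ; inverse = (λ a → mk≋ (λ n → ℤ.+-inverseˡ (a n)))
                    , (λ a → mk≋ (λ n → ℤ.+-inverseʳ (a n)))
          ; ⁻¹-cong = λ p → mk≋ (λ n → cong ℤ.-_ (at p n)) }
        ; comm = λ a b → mk≋ (λ n → ℤ.+-comm (a n) (b n)) }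
      ; *-cong = λ p q → mk≋ (λ n → ⊗-cong-≤ n (λ m _ → at p m) (λ m _ → at q m))
      ; *-assoc = λ a b c → mk≋ (λ n → ⊗-assoc-at n a b c)
      ; *-identity = (λ a → mk≋ (⊗-identityˡ-at a))
                   , (λ a → mk≋ (λ n → trans (⊗-comm-at a oneS n) (⊗-identityˡ-at a n)))
      ; distrib = (λ a b c → mk≋ (λ n → trans (⊗-comm-at a (b ⊕ c) n)
                               (trans (⊗-distribʳ-at b c a n)
                                      (cong₂ ℤ._+_ (⊗-comm-at b a n) (⊗-comm-at c a n)))))
                , (λ a b c → mk≋ (⊗-distribʳ-at b c a)) }
    ; *-comm = λ a b → mk≋ (⊗-comm-at a b) } }

open CommutativeRing seriesRing public
  using (+-cong; -‿cong)
  renaming (*-cong to ⊗-cong; *-comm to ⊗-comm; *-assoc to ⊗-assoc)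

⊗-congˡ : ∀ a {b b′} → b ≋ b′ → a ⊗ b ≋ a ⊗ b′
⊗-congˡ a = ⊗-cong (≋-refl {a})

⊗-congʳ : ∀ {a a′} b → a ≋ a′ → a ⊗ b ≋ a′ ⊗ b
⊗-congʳ b a≋a′ = ⊗-cong a≋a′ (≋-refl {b})

-- Defined like qpow 0, so that cst 1ℤ is definitionally oneS: the reflexivity proofs passed to the
-- ring solver below rely on this.
cst : ℤ → Series
cst c n = if n ℕ.≡ᵇ 0 then c else 0ℤ

cst-morphism : ℤ.+-*-rawRing -Raw-AlmostCommutative⟶ fromCommutativeRing seriesRing
cst-morphism = record
  { ⟦_⟧    = cst
  ; +-homo = λ c d → mk≋ λ { zero → refl ; (suc n) → refl }
  ; *-homo = λ c d → mk≋ λ { zero → refl ; (suc n) → sym (⊗-zero-tail c d n) }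
  ; -‿homo = λ c → mk≋ λ { zero → refl ; (suc n) → refl }
  ; 0-homo = mk≋ λ { zero → refl ; (suc n) → refl }
  ; 1-homo = mk≋ λ { zero → refl ; (suc n) → refl }
  }
  where
  ⊗-zero-tail : ∀ c d n → (cst c ⊗ cst d) (suc n) ≡ 0ℤ
  ⊗-zero-tail c d n =
    trans (⊗-unfold (cst c) (cst d) n) (cong₂ ℤ._+_ (ℤ.*-zeroʳ c) (⊗-zeroˡ-at (cst d) n))

cst-≟ : ∀ c d → Maybe (cst c ≋ cst d)
cst-≟ c d with c ℤ.≟ d
... | yes refl = just ≋-refl
... | no _     = nothing

open import Algebra.Solver.Ring ℤ.+-*-rawRing (fromCommutativeRing seriesRing) cst-morphism cst-≟
  using (solve; _:=_; _:+_; _:*_; _:-_; :-_; con)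

module ≋-Reasoning = SetoidReasoning (CommutativeRing.setoid seriesRing)

⊖-1·≋⊕ : ∀ a x → a ⊖ -1ℤ · x ≋ a ⊕ x
⊖-1·≋⊕ a x = mk≋ λ n → lemma (a n) (x n)
  where
  lemma : ∀ a x → a ℤ.- -1ℤ ℤ.* x ≡ a ℤ.+ x
  lemma = ℤ-Solver.solve-∀

·≋cst-⊗ : ∀ c x → c · x ≋ cst c ⊗ x
·≋cst-⊗ c x = mk≋ λ n → sym (begin
  (cst c ⊗ x) n            ≡⟨ ⊗-cong-≤ n {b = x} (λ i _ → cst≡·oneS i) (λ _ _ → refl) ⟩
  (c · oneS ⊗ x) n         ≡⟨ ·-⊗-at c oneS x n ⟩
  c ℤ.* (oneS ⊗ x) n       ≡⟨ cong (c ℤ.*_) (⊗-identityˡ-at x n) ⟩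
  c ℤ.* x n                ∎)
  where
  open ≡-Reasoning
  cst≡·oneS : ∀ i → cst c i ≡ c ℤ.* oneS i
  cst≡·oneS zero    = sym (ℤ.*-identityʳ c)
  cst≡·oneS (suc i) = sym (ℤ.*-zeroʳ c)

fraction-difference : ∀ p q r r′ t t′ → r ⊗ r′ ≋ oneS → t ⊗ t′ ≋ oneS →
                      p ⊗ r′ ⊖ q ⊗ t′ ≋ (r′ ⊗ t′) ⊗ (p ⊗ t ⊖ q ⊗ r)
fraction-difference p q r r′ t t′ rr′≋1 tt′≋1 = begin
  p ⊗ r′ ⊖ q ⊗ t′
    ≈⟨ solve 2 (λ a b → a :- b := a :* con 1ℤ :- b :* con 1ℤ) ≋-refl (p ⊗ r′) (q ⊗ t′) ⟩
  (p ⊗ r′) ⊗ oneS ⊖ (q ⊗ t′) ⊗ oneS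
    ≈⟨ +-cong (⊗-congˡ (p ⊗ r′) tt′≋1) (-‿cong (⊗-congˡ (q ⊗ t′) rr′≋1)) ⟨
  (p ⊗ r′) ⊗ (t ⊗ t′) ⊖ (q ⊗ t′) ⊗ (r ⊗ r′)
    ≈⟨ solve 6 (λ p q r r′ t t′ → (p :* r′) :* (t :* t′) :- (q :* t′) :* (r :* r′)
                                   := (r′ :* t′) :* (p :* t :- q :* r)) ≋-refl p q r r′ t t′ ⟩
  (r′ ⊗ t′) ⊗ (p ⊗ t ⊖ q ⊗ r)
    ∎
  where open ≋-Reasoning

-- Truncations, valuations and inverses

AgreeUpTo : ℕ → Series → Series → Set
AgreeUpTo n a b = ∀ m → m ≤ n → a m ≡ b m

VanishesBelow : ℕ → Series → Set
VanishesBelow j a = ∀ m → m < j → a m ≡ 0ℤ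

⊗-agree : ∀ n {a a′ b b′} → AgreeUpTo n a a′ → AgreeUpTo n b b′ → AgreeUpTo n (a ⊗ b) (a′ ⊗ b′)
⊗-agree n a≈a′ b≈b′ m m≤n =
  ⊗-cong-≤ m (λ i i≤m → a≈a′ i (ℕ.≤-trans i≤m m≤n)) (λ i i≤m → b≈b′ i (ℕ.≤-trans i≤m m≤n))

powS-agree : ∀ n {a a′} → AgreeUpTo n a a′ → ∀ j → AgreeUpTo n (powS a j) (powS a′ j)
powS-agree n a≈a′ zero    m _ = refl
powS-agree n a≈a′ (suc j) = ⊗-agree n a≈a′ (powS-agree n a≈a′ j)

vanishes-mono : ∀ {i j a} → i ≤ j → VanishesBelow j a → VanishesBelow i a
vanishes-mono i≤j a≈0 m m<i = a≈0 m (ℕ.<-≤-trans m<i i≤j)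

vanishes-⊗ʳ : ∀ {j} a {b} → VanishesBelow j b → VanishesBelow j (a ⊗ b)
vanishes-⊗ʳ a {b} b≈0 m m<j = sumTo-zero m _ (λ i i≤m →
  trans (cong (a i ℤ.*_) (b≈0 (m ∸ i) (ℕ.≤-<-trans (ℕ.m∸n≤m m i) m<j))) (ℤ.*-zeroʳ (a i)))

vanishes-⊗ˡ : ∀ {j a} b → VanishesBelow j a → VanishesBelow j (a ⊗ b)
vanishes-⊗ˡ {a = a} b a≈0 m m<j = trans (⊗-comm-at a b m) (vanishes-⊗ʳ b a≈0 m m<j)

qpow-suc-⊗-zero : ∀ e y → (qpow (suc e) ⊗ y) 0 ≡ 0ℤ
qpow-suc-⊗-zero e y = ℤ.*-zeroˡ (y 0)

qpow-suc-⊗-suc : ∀ e y n → (qpow (suc e) ⊗ y) (suc n) ≡ (qpow e ⊗ y) n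
qpow-suc-⊗-suc e y n = trans (⊗-unfold (qpow (suc e)) y n)
  (trans (cong (ℤ._+ (qpow e ⊗ y) n) (ℤ.*-zeroˡ (y (suc n)))) (ℤ.+-identityˡ _))

qpow-⊗-vanishes : ∀ e y → VanishesBelow e (qpow e ⊗ y)
qpow-⊗-vanishes (suc e) y zero    _         = qpow-suc-⊗-zero e y
qpow-⊗-vanishes (suc e) y (suc m) (s≤s m<e) = trans (qpow-suc-⊗-suc e y m) (qpow-⊗-vanishes e y m m<e)

·qpow-vanishes : ∀ c e → VanishesBelow e (c · qpow e)
·qpow-vanishes c e i i<e = begin
  c ℤ.* qpow e i           ≡⟨ cong (c ℤ.*_) (at (solve 1 (λ x → x := x :* con 1ℤ) ≋-refl (qpow e)) i) ⟩
  c ℤ.* (qpow e ⊗ oneS) i  ≡⟨ cong (c ℤ.*_) (qpow-⊗-vanishes e oneS i i<e) ⟩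
  c ℤ.* 0ℤ                 ≡⟨ ℤ.*-zeroʳ c ⟩
  0ℤ                       ∎
  where open ≡-Reasoning

qpow-⊗-qpow : ∀ a b → qpow a ⊗ qpow b ≋ qpow (a ℕ.+ b)
qpow-⊗-qpow a b = mk≋ (go a)
  where
  go : ∀ a n → (qpow a ⊗ qpow b) n ≡ qpow (a ℕ.+ b) n
  go zero    n       = ⊗-identityˡ-at (qpow b) n
  go (suc a) zero    = qpow-suc-⊗-zero a (qpow b)
  go (suc a) (suc n) = trans (qpow-suc-⊗-suc a (qpow b) n) (go a n)

powS-vanishes : ∀ b → b 0 ≡ 0ℤ → ∀ j → VanishesBelow j (powS b j)
powS-vanishes b b₀≡0 (suc j) zero    _ =
  trans (cong (ℤ._* powS b j 0) b₀≡0) (ℤ.*-zeroˡ (powS b j 0))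
powS-vanishes b b₀≡0 (suc j) (suc m) (s≤s m<j) = begin
  (b ⊗ powS b j) (suc m)
    ≡⟨ ⊗-unfold b (powS b j) m ⟩
  b 0 ℤ.* powS b j (suc m) ℤ.+ (shift b ⊗ powS b j) m
    ≡⟨ cong₂ ℤ._+_ (trans (cong (ℤ._* powS b j (suc m)) b₀≡0) (ℤ.*-zeroˡ (powS b j (suc m))))
                   (vanishes-⊗ʳ (shift b) (powS-vanishes b b₀≡0 j) m m<j) ⟩
  0ℤ
    ∎
  where open ≡-Reasoning

finSum-at : ∀ n (f : ℕ → Series) m → finSum (suc n) f m ≡ sumTo n (λ j → f j m)
finSum-at zero    f m = ℤ.+-identityˡ (f 0 m)
finSum-at (suc n) f m = cong (ℤ._+ f (suc n) m) (finSum-at n f m)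

finSum-stable : ∀ {f : ℕ → Series} → (∀ j → VanishesBelow j (f j)) →
                ∀ {m M} → m < M → finSum M f m ≡ finSum (suc m) f m
finSum-stable {f} f≈0 {m} {suc M} (s≤s m≤M) = begin
  finSum (suc M) f m         ≡⟨ finSum-at M f m ⟩
  sumTo M (λ j → f j m)      ≡⟨ sumTo-extend (λ j → f j m) m≤M (λ j m<j → f≈0 j m m<j) ⟩
  sumTo m (λ j → f j m)      ≡⟨ finSum-at m f m ⟨
  finSum (suc m) f m         ∎
  where open ≡-Reasoning

module _ {a : Series} (a₀≡1 : a 0 ≡ 1ℤ) where

  private
    b : Series
    b = oneS ⊖ a

    b₀≡0 : b 0 ≡ 0ℤ
    b₀≡0 = cong (ℤ._-_ 1ℤ) a₀≡1

    partialSum : ℕ → Series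
    partialSum N = finSum N (powS b)

    telescope : ∀ N → a ⊗ partialSum N ≋ oneS ⊖ powS b N
    telescope zero    = mk≋ λ n →
      trans (⊗-comm-at a 0S n) (trans (⊗-zeroˡ-at a n) (sym (ℤ.+-inverseʳ (oneS n))))
    telescope (suc N) = begin
      a ⊗ (partialSum N ⊕ p)
        ≈⟨ solve 3 (λ a s p → a :* (s :+ p) := a :* s :+ a :* p) ≋-refl a (partialSum N) p ⟩
      a ⊗ partialSum N ⊕ a ⊗ p
        ≈⟨ +-cong (telescope N) ≋-refl ⟩
      (oneS ⊖ p) ⊕ a ⊗ p
        ≈⟨ solve 2 (λ a p → (con 1ℤ :- p) :+ a :* p := con 1ℤ :- (con 1ℤ :- a) :* p) ≋-refl a p ⟩
      oneS ⊖ b ⊗ p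
        ∎
      where
      open ≋-Reasoning
      p = powS b N

    invS-agrees : ∀ {m N} → m < N → invS a m ≡ partialSum N m
    invS-agrees {m} m<N =
      trans (sym (finSum-at m (powS b) m)) (sym (finSum-stable (powS-vanishes b b₀≡0) m<N))

  invS-inverseʳ : a ⊗ invS a ≋ oneS
  invS-inverseʳ = mk≋ λ n → begin
    (a ⊗ invS a) n                  ≡⟨ ⊗-congˡ-≤ n a (λ m m≤n → invS-agrees (s≤s m≤n)) ⟩
    (a ⊗ partialSum (suc n)) n      ≡⟨ at (telescope (suc n)) n ⟩
    oneS n ℤ.- powS b (suc n) n     ≡⟨ cong (ℤ._-_ (oneS n)) (powS-vanishes b b₀≡0 (suc n) n ℕ.≤-refl) ⟩
    oneS n ℤ.- 0ℤ                   ≡⟨ ℤ.+-identityʳ (oneS n) ⟩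
    oneS n                          ∎
    where open ≡-Reasoning

  invS-unique : ∀ {x} → x ⊗ a ≋ oneS → x ≋ invS a
  invS-unique {x} x⊗a≋1 = begin
    x                     ≈⟨ solve 1 (λ x → x := x :* con 1ℤ) ≋-refl x ⟩
    x ⊗ oneS              ≈⟨ ⊗-congˡ x invS-inverseʳ ⟨
    x ⊗ (a ⊗ invS a)      ≈⟨ ⊗-assoc x a (invS a) ⟨
    (x ⊗ a) ⊗ invS a      ≈⟨ ⊗-congʳ (invS a) x⊗a≋1 ⟩
    oneS ⊗ invS a         ≈⟨ solve 1 (λ y → con 1ℤ :* y := y) ≋-refl (invS a) ⟩
    invS a                ∎
    where open ≋-Reasoning

invS-oneS : invS oneS ≋ oneS
invS-oneS = ≋-sym (invS-unique refl (solve 0 (con 1ℤ :* con 1ℤ := con 1ℤ) ≋-refl))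

invS-agree : ∀ n {a a′} → AgreeUpTo n a a′ → AgreeUpTo n (invS a) (invS a′)
invS-agree n a≈a′ m m≤n = sumTo-cong m (λ j _ →
  powS-agree n (λ i i≤n → cong (ℤ._-_ (oneS i)) (a≈a′ i i≤n)) j m m≤n)

invS-cong : ∀ {a a′} → a ≋ a′ → invS a ≋ invS a′
invS-cong a≋a′ = mk≋ (λ n → invS-agree n (λ m _ → at a≋a′ m) n ℕ.≤-refl)

invS-⊗ : ∀ {a b} → a 0 ≡ 1ℤ → b 0 ≡ 1ℤ → invS (a ⊗ b) ≋ invS a ⊗ invS b
invS-⊗ {a} {b} a₀≡1 b₀≡1 = ≋-sym (invS-unique (cong₂ ℤ._*_ a₀≡1 b₀≡1) (begin
  (invS a ⊗ invS b) ⊗ (a ⊗ b)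
    ≈⟨ solve 4 (λ x y u v → (x :* y) :* (u :* v) := (u :* x) :* (v :* y)) ≋-refl (invS a) (invS b) a b ⟩
  (a ⊗ invS a) ⊗ (b ⊗ invS b)   ≈⟨ ⊗-cong (invS-inverseʳ {a} a₀≡1) (invS-inverseʳ {b} b₀≡1) ⟩
  oneS ⊗ oneS                   ≈⟨ solve 0 (con 1ℤ :* con 1ℤ := con 1ℤ) ≋-refl ⟩
  oneS                          ∎))
  where open ≋-Reasoning

invS-⊗-cancelʳ : ∀ {a b} → a 0 ≡ 1ℤ → b 0 ≡ 1ℤ → invS (a ⊗ b) ⊗ b ≋ invS a
invS-⊗-cancelʳ {a} {b} a₀≡1 b₀≡1 = begin
  invS (a ⊗ b) ⊗ b           ≈⟨ ⊗-congʳ b (invS-⊗ a₀≡1 b₀≡1) ⟩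
  (invS a ⊗ invS b) ⊗ b
    ≈⟨ solve 3 (λ x y b → (x :* y) :* b := x :* (b :* y)) ≋-refl (invS a) (invS b) b ⟩
  invS a ⊗ (b ⊗ invS b)      ≈⟨ ⊗-congˡ (invS a) (invS-inverseʳ {b} b₀≡1) ⟩
  invS a ⊗ oneS              ≈⟨ solve 1 (λ x → x :* con 1ℤ := x) ≋-refl (invS a) ⟩
  invS a                     ∎
  where open ≋-Reasoning

finProd-constant : ∀ N (h : ℕ → Series) → (∀ t → h t 0 ≡ 1ℤ) → finProd N h 0 ≡ 1ℤ
finProd-constant zero    h h₀≡1 = refl
finProd-constant (suc N) h h₀≡1 = cong₂ ℤ._*_ (finProd-constant N h h₀≡1) (h₀≡1 N)

invS-finProd : ∀ N (h : ℕ → Series) → (∀ t → h t 0 ≡ 1ℤ) → invS (finProd N h) ≋ finProd N (invS ∘ h)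
invS-finProd zero    h h₀≡1 = invS-oneS
invS-finProd (suc N) h h₀≡1 = ≋-trans (invS-⊗ (finProd-constant N h h₀≡1) (h₀≡1 N))
                                      (⊗-congʳ (invS (h N)) (invS-finProd N h h₀≡1))

powS-constant : ∀ {a} → a 0 ≡ 1ℤ → ∀ j → powS a j 0 ≡ 1ℤ
powS-constant a₀≡1 zero    = refl
powS-constant a₀≡1 (suc j) = cong₂ ℤ._*_ a₀≡1 (powS-constant a₀≡1 j)

powS-cong : ∀ {a a′} → a ≋ a′ → ∀ j → powS a j ≋ powS a′ j
powS-cong a≋a′ zero    = ≋-refl
powS-cong a≋a′ (suc j) = ⊗-cong a≋a′ (powS-cong a≋a′ j)

invS-powS : ∀ {a} → a 0 ≡ 1ℤ → ∀ j → invS (powS a j) ≋ powS (invS a) j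
invS-powS a₀≡1 zero    = invS-oneS
invS-powS {a} a₀≡1 (suc j) = ≋-trans (invS-⊗ a₀≡1 (powS-constant a₀≡1 j))
                                     (⊗-congˡ (invS a) (invS-powS a₀≡1 j))

-- Non-negativity and q-Pochhammer symbols

nonNeg-resp : ∀ {a b} → a ≋ b → NonNegCoeffs a → NonNegCoeffs b
nonNeg-resp a≋b a≥0 n = subst (0ℤ ℤ.≤_) (at a≋b n) (a≥0 n)

nonNeg-⊕ : ∀ {a b} → NonNegCoeffs a → NonNegCoeffs b → NonNegCoeffs (a ⊕ b)
nonNeg-⊕ a≥0 b≥0 n = ℤ.+-mono-≤ (a≥0 n) (b≥0 n)

*-nonNeg : ∀ {i j} → 0ℤ ℤ.≤ i → 0ℤ ℤ.≤ j → 0ℤ ℤ.≤ i ℤ.* j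
*-nonNeg {+ m} {+ n} _ _ = subst (0ℤ ℤ.≤_) (ℤ.pos-* m n) (+≤+ z≤n)

nonNeg-⊗ : ∀ {a b} → NonNegCoeffs a → NonNegCoeffs b → NonNegCoeffs (a ⊗ b)
nonNeg-⊗ a≥0 b≥0 n = sumTo-nonNeg n _ (λ i _ → *-nonNeg (a≥0 i) (b≥0 (n ∸ i)))

nonNeg-qpow : ∀ m → NonNegCoeffs (qpow m)
nonNeg-qpow m n with n ℕ.≡ᵇ m
... | true  = +≤+ z≤n
... | false = +≤+ z≤n

nonNeg-oneS : NonNegCoeffs oneS
nonNeg-oneS = nonNeg-qpow 0

nonNeg-cst : ∀ m → NonNegCoeffs (cst (+ m))
nonNeg-cst m zero    = +≤+ z≤n
nonNeg-cst m (suc n) = +≤+ z≤n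

nonNeg-powS : ∀ {a} → NonNegCoeffs a → ∀ j → NonNegCoeffs (powS a j)
nonNeg-powS a≥0 zero    = nonNeg-oneS
nonNeg-powS a≥0 (suc j) = nonNeg-⊗ a≥0 (nonNeg-powS a≥0 j)

nonNeg-finProd : ∀ N {h : ℕ → Series} → (∀ t → NonNegCoeffs (h t)) → NonNegCoeffs (finProd N h)
nonNeg-finProd zero    h≥0 = nonNeg-oneS
nonNeg-finProd (suc N) h≥0 = nonNeg-⊗ (nonNeg-finProd N h≥0) (h≥0 N)

nonNeg-invS : ∀ {a} → NonNegCoeffs (oneS ⊖ a) → NonNegCoeffs (invS a)
nonNeg-invS 1-a≥0 n = sumTo-nonNeg n _ (λ j _ → nonNeg-powS 1-a≥0 j n)

nonNeg-infSum : ∀ {f : ℕ → Series} → (∀ j → NonNegCoeffs (f j)) → NonNegCoeffs (infSum f)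
nonNeg-infSum f≥0 n = sumTo-nonNeg n _ (λ j _ → f≥0 j n)

finProd-cong : ∀ N {h h′ : ℕ → Series} → (∀ t → h t ≋ h′ t) → finProd N h ≋ finProd N h′
finProd-cong zero    h≋h′ = ≋-refl
finProd-cong (suc N) h≋h′ = ⊗-cong (finProd-cong N h≋h′) (h≋h′ N)

finProd-⊗ : ∀ N (h h′ : ℕ → Series) → finProd N (λ t → h t ⊗ h′ t) ≋ finProd N h ⊗ finProd N h′
finProd-⊗ zero    h h′ = solve 0 (con 1ℤ := con 1ℤ :* con 1ℤ) ≋-refl
finProd-⊗ (suc N) h h′ = ≋-trans (⊗-congʳ (h N ⊗ h′ N) (finProd-⊗ N h h′))
  (solve 4 (λ a b c d → (a :* b) :* (c :* d) := (a :* c) :* (b :* d)) ≋-refl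
     (finProd N h) (finProd N h′) (h N) (h′ N))

finProd-+ : ∀ M N (h : ℕ → Series) → finProd (M ℕ.+ N) h ≋ finProd M h ⊗ finProd N (λ t → h (M ℕ.+ t))
finProd-+ M zero    h rewrite ℕ.+-identityʳ M = solve 1 (λ a → a := a :* con 1ℤ) ≋-refl (finProd M h)
finProd-+ M (suc N) h rewrite ℕ.+-suc M N = ≋-trans (⊗-congʳ (h (M ℕ.+ N)) (finProd-+ M N h))
  (solve 3 (λ a b c → (a :* b) :* c := a :* (b :* c)) ≋-refl
     (finProd M h) (finProd N (λ t → h (M ℕ.+ t))) (h (M ℕ.+ N)))

geometric : ℕ → Series
geometric m = invS (oneS ⊖ qpow m)

qPoch : ℕ → ℕ → ℕ → Series
qPoch a s L = finProd L (λ t → oneS ⊖ qpow (a ℕ.+ s ℕ.* t))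

invPoch : ℕ → ℕ → ℕ → Series
invPoch a s L = finProd L (λ t → geometric (a ℕ.+ s ℕ.* t))

nonNeg-geometric : ∀ m → NonNegCoeffs (geometric m)
nonNeg-geometric m =
  nonNeg-invS (nonNeg-resp (solve 1 (λ x → x := con 1ℤ :- (con 1ℤ :- x)) ≋-refl (qpow m)) (nonNeg-qpow m))

nonNeg-invPoch : ∀ a s L → NonNegCoeffs (invPoch a s L)
nonNeg-invPoch a s L = nonNeg-finProd L (λ t → nonNeg-geometric _)

geometric-inverse : ∀ m → (oneS ⊖ qpow (suc m)) ⊗ geometric (suc m) ≋ oneS
geometric-inverse m = invS-inverseʳ {oneS ⊖ qpow (suc m)} refl

qPoch-⊗-invPoch : ∀ a s L → qPoch (suc a) s L ⊗ invPoch (suc a) s L ≋ oneS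
qPoch-⊗-invPoch a s L = ≋-trans (≋-sym (finProd-⊗ L _ _)) (finProd-one L)
  where
  finProd-one : ∀ L →
    finProd L (λ t → (oneS ⊖ qpow (suc a ℕ.+ s ℕ.* t)) ⊗ geometric (suc a ℕ.+ s ℕ.* t)) ≋ oneS
  finProd-one zero    = ≋-refl
  finProd-one (suc L) = ≋-trans (⊗-cong (finProd-one L) (geometric-inverse (a ℕ.+ s ℕ.* L)))
                                (solve 0 (con 1ℤ :* con 1ℤ := con 1ℤ) ≋-refl)

invPoch-+ : ∀ a s M N → invPoch a s (M ℕ.+ N) ≋ invPoch a s M ⊗ invPoch (a ℕ.+ s ℕ.* M) s N
invPoch-+ a s M N = ≋-trans (finProd-+ M N _)
  (⊗-congˡ (invPoch a s M) (finProd-cong N (λ t → ≡⇒≋ (cong geometric (exponent t)))))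
  where
  exponent : ∀ t → a ℕ.+ s ℕ.* (M ℕ.+ t) ≡ (a ℕ.+ s ℕ.* M) ℕ.+ s ℕ.* t
  exponent t = ℕ-Solver.solve (a ∷ s ∷ M ∷ t ∷ [])

invS-poch-one : ∀ a s N → invS (poch 1ℤ (suc a) s N) ≋ invPoch (suc a) s N
invS-poch-one a s N = ≋-trans (invS-finProd N _ (λ t → refl))
  (finProd-cong N (λ t → invS-cong (mk≋ (λ n → cong (ℤ._-_ (oneS n)) (ℤ.*-identityˡ _)))))

geometric-inverse² : ∀ m → (oneS ⊖ qpow (suc m) ⊗ qpow (suc m)) ⊗ geometric (2 ℕ.* suc m) ≋ oneS
geometric-inverse² m = ≋-trans
  (⊗-congʳ (geometric (2 ℕ.* suc m))
    (+-cong (≋-refl {oneS}) (-‿cong (≋-trans (qpow-⊗-qpow (suc m) (suc m)) (≡⇒≋ (cong qpow m+m≡2m))))))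
  (geometric-inverse _)
  where
  m+m≡2m : suc m ℕ.+ suc m ≡ 2 ℕ.* suc m
  m+m≡2m = ℕ-Solver.solve (m ∷ [])

invS-onePlusQ : ∀ m → invS (oneS ⊕ qpow (suc m)) ≋ (oneS ⊖ qpow (suc m)) ⊗ geometric (2 ℕ.* suc m)
invS-onePlusQ m = ≋-sym (invS-unique refl (begin
  ((oneS ⊖ x) ⊗ g²) ⊗ (oneS ⊕ x)
    ≈⟨ solve 2 (λ x g → ((con 1ℤ :- x) :* g) :* (con 1ℤ :+ x) := (con 1ℤ :- x :* x) :* g) ≋-refl x g² ⟩
  (oneS ⊖ x ⊗ x) ⊗ g²              ≈⟨ geometric-inverse² m ⟩
  oneS                             ∎))
  where
  open ≋-Reasoning
  x = qpow (suc m)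
  g² = geometric (2 ℕ.* suc m)

invS-poch-minusOne : ∀ a s L →
  invS (poch -1ℤ (suc a) s L) ≋ qPoch (suc a) s L ⊗ invPoch (2 ℕ.* suc a) (2 ℕ.* s) L
invS-poch-minusOne a s L = begin
  invS (poch -1ℤ (suc a) s L)
    ≈⟨ invS-finProd L _ (λ t → refl) ⟩
  finProd L (λ t → invS (oneS ⊖ -1ℤ · qpow (suc a ℕ.+ s ℕ.* t)))
    ≈⟨ finProd-cong L (λ t → ≋-trans (invS-cong (⊖-1·≋⊕ oneS (qpow (suc a ℕ.+ s ℕ.* t)))) (factor t)) ⟩
  finProd L (λ t → (oneS ⊖ qpow (suc a ℕ.+ s ℕ.* t)) ⊗ geometric (2 ℕ.* suc a ℕ.+ 2 ℕ.* s ℕ.* t))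
    ≈⟨ finProd-⊗ L _ _ ⟩
  qPoch (suc a) s L ⊗ invPoch (2 ℕ.* suc a) (2 ℕ.* s) L
    ∎
  where
  open ≋-Reasoning
  factor : ∀ t → invS (oneS ⊕ qpow (suc a ℕ.+ s ℕ.* t)) ≋
                 (oneS ⊖ qpow (suc a ℕ.+ s ℕ.* t)) ⊗ geometric (2 ℕ.* suc a ℕ.+ 2 ℕ.* s ℕ.* t)
  factor t = ≋-trans (invS-onePlusQ (a ℕ.+ s ℕ.* t))
    (⊗-congˡ (oneS ⊖ qpow (suc a ℕ.+ s ℕ.* t)) (≡⇒≋ (cong geometric (ℕ-Solver.solve (a ∷ s ∷ t ∷ [])))))

evenPowers : ℕ → Series
evenPowers m = finSum m (λ t → qpow (2 ℕ.* t))

nonNeg-evenPowers : ∀ m → NonNegCoeffs (evenPowers m)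
nonNeg-evenPowers zero    n = +≤+ z≤n
nonNeg-evenPowers (suc m) = nonNeg-⊕ (nonNeg-evenPowers m) (nonNeg-qpow (2 ℕ.* m))

oneMinusQ²-⊗-evenPowers : ∀ m → (oneS ⊖ qpow 2) ⊗ evenPowers m ≋ oneS ⊖ qpow (2 ℕ.* m)
oneMinusQ²-⊗-evenPowers zero    = mk≋ λ n →
  trans (⊗-comm-at (oneS ⊖ qpow 2) 0S n) (trans (⊗-zeroˡ-at (oneS ⊖ qpow 2) n) (sym (ℤ.+-inverseʳ (oneS n))))
oneMinusQ²-⊗-evenPowers (suc m) = begin
  (oneS ⊖ x) ⊗ (evenPowers m ⊕ y)
    ≈⟨ solve 3 (λ x g y → (con 1ℤ :- x) :* (g :+ y) := (con 1ℤ :- x) :* g :+ y :- x :* y)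
               ≋-refl x (evenPowers m) y ⟩
  (oneS ⊖ x) ⊗ evenPowers m ⊕ y ⊖ x ⊗ y
    ≈⟨ +-cong (+-cong (oneMinusQ²-⊗-evenPowers m) ≋-refl)
              (-‿cong (≋-trans (qpow-⊗-qpow 2 (2 ℕ.* m)) (≡⇒≋ (cong qpow (sym (ℕ.*-suc 2 m)))))) ⟩
  (oneS ⊖ y) ⊕ y ⊖ qpow (2 ℕ.* suc m)
    ≈⟨ solve 2 (λ y y′ → (con 1ℤ :- y) :+ y :- y′ := con 1ℤ :- y′) ≋-refl y (qpow (2 ℕ.* suc m)) ⟩
  oneS ⊖ qpow (2 ℕ.* suc m)
    ∎
  where
  open ≋-Reasoning
  x = qpow 2
  y = qpow (2 ℕ.* m)

qpow²-difference : ∀ m → qpow 2 ⊖ qpow (2 ℕ.+ 2 ℕ.* m) ≋ qpow 2 ⊗ ((oneS ⊖ qpow 2) ⊗ evenPowers m)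
qpow²-difference m = begin
  qpow 2 ⊖ qpow (2 ℕ.+ 2 ℕ.* m)          ≈⟨ +-cong (≋-refl {qpow 2}) (-‿cong (qpow-⊗-qpow 2 (2 ℕ.* m))) ⟨
  qpow 2 ⊖ qpow 2 ⊗ qpow (2 ℕ.* m)
    ≈⟨ solve 2 (λ x y → x :- x :* y := x :* (con 1ℤ :- y)) ≋-refl (qpow 2) (qpow (2 ℕ.* m)) ⟩
  qpow 2 ⊗ (oneS ⊖ qpow (2 ℕ.* m))       ≈⟨ ⊗-congˡ (qpow 2) (oneMinusQ²-⊗-evenPowers m) ⟨
  qpow 2 ⊗ ((oneS ⊖ qpow 2) ⊗ evenPowers m) ∎
  where open ≋-Reasoning

-- Absorption of numerator factors by 1/(q^a; q^s)_∞

record Absorbed (a s : ℕ) (A : Series) : Set where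
  constructor absorbed
  field
    level   : ℕ
    nonNeg≥ : ∀ N → level ≤ N → NonNegCoeffs (A ⊗ invPoch a s N)

nonNeg⇒Absorbed : ∀ {a s A} → NonNegCoeffs A → Absorbed a s A
nonNeg⇒Absorbed {a} {s} A≥0 = absorbed 0 λ N _ → nonNeg-⊗ A≥0 (nonNeg-invPoch a s N)

Absorbed-resp : ∀ {a s A B} → A ≋ B → Absorbed a s A → Absorbed a s B
Absorbed-resp {a} {s} A≋B (absorbed K absorbs) =
  absorbed K λ N K≤N → nonNeg-resp (⊗-congʳ (invPoch a s N) A≋B) (absorbs N K≤N)

Absorbed-⊗ˡ : ∀ {a s U A} → NonNegCoeffs U → Absorbed a s A → Absorbed a s (U ⊗ A)
Absorbed-⊗ˡ {a} {s} {U} {A} U≥0 (absorbed K absorbs) = absorbed K λ N K≤N →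
  nonNeg-resp (≋-sym (⊗-assoc U A (invPoch a s N))) (nonNeg-⊗ U≥0 (absorbs N K≤N))

Absorbed-⊕ : ∀ {a s A B} → Absorbed a s A → Absorbed a s B → Absorbed a s (A ⊕ B)
Absorbed-⊕ {a} {s} {A} {B} (absorbed K A-absorbs) (absorbed K′ B-absorbs) = absorbed (K ⊔ K′) λ N K⊔K′≤N →
  nonNeg-resp (solve 3 (λ a b p → a :* p :+ b :* p := (a :+ b) :* p) ≋-refl A B (invPoch a s N))
    (nonNeg-⊕ (A-absorbs N (ℕ.≤-trans (ℕ.m≤m⊔n K K′) K⊔K′≤N))
              (B-absorbs N (ℕ.≤-trans (ℕ.m≤n⊔m K K′) K⊔K′≤N)))

Absorbed-finSum : ∀ {a s} n {h : ℕ → Series} → (∀ i → i < n → Absorbed a s (h i)) →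
                  Absorbed a s (finSum n h)
Absorbed-finSum zero    h-absorbed = nonNeg⇒Absorbed (λ _ → +≤+ z≤n)
Absorbed-finSum (suc n) h-absorbed = Absorbed-⊕
  (Absorbed-finSum n (λ i i<n → h-absorbed i (ℕ.m<n⇒m<1+n i<n))) (h-absorbed n ℕ.≤-refl)

private
  split-≤ : ∀ {M K N} → M ℕ.+ K ≤ N → Σ[ N′ ∈ ℕ ] (N ≡ M ℕ.+ N′ × K ≤ N′)
  split-≤ {M} {K} {N} M+K≤N =
    N ∸ M
    , sym (ℕ.m+[n∸m]≡n (ℕ.≤-trans (ℕ.m≤m+n M K) M+K≤N))
    , subst (_≤ N ∸ M) (ℕ.m+n∸m≡n M K) (ℕ.∸-monoˡ-≤ M M+K≤N)

  Absorbed-split : ∀ {a s} M {A B} →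
    (∀ N′ → NonNegCoeffs (A ⊗ invPoch (a ℕ.+ s ℕ.* M) s N′) → NonNegCoeffs (B ⊗ invPoch a s (M ℕ.+ N′))) →
    Absorbed (a ℕ.+ s ℕ.* M) s A → Absorbed a s B
  Absorbed-split {a} {s} M {B = B} step (absorbed K absorbs) = absorbed (M ℕ.+ K) absorbs′
    where
    absorbs′ : ∀ N → M ℕ.+ K ≤ N → NonNegCoeffs (B ⊗ invPoch a s N)
    absorbs′ N M+K≤N with split-≤ {M} M+K≤N
    ... | N′ , refl , K≤N′ = step N′ (absorbs N′ K≤N′)

Absorbed-skip : ∀ {a s} M {A} → Absorbed (a ℕ.+ s ℕ.* M) s A → Absorbed a s A
Absorbed-skip {a} {s} M {A} = Absorbed-split M λ N′ A-absorbs → nonNeg-resp (begin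
  invPoch a s M ⊗ (A ⊗ invPoch (a ℕ.+ s ℕ.* M) s N′)
    ≈⟨ solve 3 (λ p a p′ → p :* (a :* p′) := a :* (p :* p′)) ≋-refl
         (invPoch a s M) A (invPoch (a ℕ.+ s ℕ.* M) s N′) ⟩
  A ⊗ (invPoch a s M ⊗ invPoch (a ℕ.+ s ℕ.* M) s N′)
    ≈⟨ ⊗-congˡ A (invPoch-+ a s M N′) ⟨
  A ⊗ invPoch a s (M ℕ.+ N′)
    ∎) (nonNeg-⊗ (nonNeg-invPoch a s M) A-absorbs)
  where open ≋-Reasoning

Absorbed-cancel : ∀ {a s} L {A} → Absorbed (suc a ℕ.+ s ℕ.* L) s A →
                  Absorbed (suc a) s (qPoch (suc a) s L ⊗ A)
Absorbed-cancel {a} {s} L {A} = Absorbed-split L λ N′ A-absorbs → nonNeg-resp (begin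
  A ⊗ invPoch (suc a ℕ.+ s ℕ.* L) s N′
    ≈⟨ solve 2 (λ a p′ → a :* p′ := con 1ℤ :* (a :* p′)) ≋-refl A (invPoch (suc a ℕ.+ s ℕ.* L) s N′) ⟩
  oneS ⊗ (A ⊗ invPoch (suc a ℕ.+ s ℕ.* L) s N′)
    ≈⟨ ⊗-congʳ (A ⊗ invPoch (suc a ℕ.+ s ℕ.* L) s N′) (qPoch-⊗-invPoch a s L) ⟨
  (qPoch (suc a) s L ⊗ invPoch (suc a) s L) ⊗ (A ⊗ invPoch (suc a ℕ.+ s ℕ.* L) s N′)
    ≈⟨ solve 4 (λ f p a p′ → (f :* p) :* (a :* p′) := (f :* a) :* (p :* p′)) ≋-refl
         (qPoch (suc a) s L) (invPoch (suc a) s L) A (invPoch (suc a ℕ.+ s ℕ.* L) s N′) ⟩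
  (qPoch (suc a) s L ⊗ A) ⊗ (invPoch (suc a) s L ⊗ invPoch (suc a ℕ.+ s ℕ.* L) s N′)
    ≈⟨ ⊗-congˡ (qPoch (suc a) s L ⊗ A) (invPoch-+ (suc a) s L N′) ⟨
  (qPoch (suc a) s L ⊗ A) ⊗ invPoch (suc a) s (L ℕ.+ N′)
    ∎) A-absorbs
  where open ≋-Reasoning

Absorbed-oneMinusQ-⊗ : ∀ {a s} t {A} → Absorbed (suc a ℕ.+ s ℕ.* suc t) s A →
                       Absorbed (suc a) s ((oneS ⊖ qpow (suc a ℕ.+ s ℕ.* t)) ⊗ A)
Absorbed-oneMinusQ-⊗ {a} {s} t {A} A-absorbed =
  Absorbed-skip t (Absorbed-resp single-factor
    (Absorbed-cancel 1 (subst (λ e → Absorbed e s A) next A-absorbed)))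
  where
  next : suc a ℕ.+ s ℕ.* suc t ≡ (suc a ℕ.+ s ℕ.* t) ℕ.+ s ℕ.* 1
  next = ℕ-Solver.solve (a ∷ s ∷ t ∷ [])
  single-factor : qPoch (suc a ℕ.+ s ℕ.* t) s 1 ⊗ A ≋ (oneS ⊖ qpow (suc a ℕ.+ s ℕ.* t)) ⊗ A
  single-factor = ≋-trans
    (solve 2 (λ x a → (con 1ℤ :* (con 1ℤ :- x)) :* a := (con 1ℤ :- x) :* a) ≋-refl (qpow _) A)
    (⊗-congʳ A (≡⇒≋ (cong (λ e → oneS ⊖ qpow e) (ℕ-Solver.solve (a ∷ s ∷ t ∷ [])))))

oneMinusQ-absorbed : ∀ a s t → Absorbed (suc a) s (oneS ⊖ qpow (suc a ℕ.+ s ℕ.* t))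
oneMinusQ-absorbed a s t = Absorbed-resp (solve 1 (λ x → x :* con 1ℤ := x) ≋-refl _)
  (Absorbed-oneMinusQ-⊗ t (nonNeg⇒Absorbed nonNeg-oneS))

qPoch-absorbed : ∀ a s M L → Absorbed (suc a) s (qPoch (suc a ℕ.+ s ℕ.* M) s L)
qPoch-absorbed a s M L = Absorbed-skip M (Absorbed-resp (solve 1 (λ x → x :* con 1ℤ := x) ≋-refl _)
  (Absorbed-cancel L (nonNeg⇒Absorbed nonNeg-oneS)))

oneMinusQ²-absorbed : ∀ e t → e ≡ 2 ℕ.+ 2 ℕ.* t → Absorbed 2 2 (oneS ⊖ qpow e)
oneMinusQ²-absorbed _ t refl = oneMinusQ-absorbed 1 2 t

onePlusQ⁻¹-absorbed : ∀ {e} t → e ≡ 2 ℕ.+ 2 ℕ.* t → Absorbed 2 2 (invS (oneS ⊕ qpow e))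
onePlusQ⁻¹-absorbed t refl = Absorbed-resp
  (≋-trans (⊗-comm (geometric e′) (oneS ⊖ qpow (2 ℕ.+ 2 ℕ.* t))) (≋-sym (invS-onePlusQ (1 ℕ.+ 2 ℕ.* t))))
  (Absorbed-⊗ˡ (nonNeg-geometric e′) (oneMinusQ-absorbed 1 2 t))
  where e′ = 2 ℕ.* (2 ℕ.+ 2 ℕ.* t)

invS-poch-minusOne-absorbed : ∀ k L → Absorbed 2 2 (invS (poch -1ℤ (2 ℕ.* k ℕ.+ 2) 2 L))
invS-poch-minusOne-absorbed k L = subst (λ a → Absorbed 2 2 (invS (poch -1ℤ a 2 L))) (ℕ.+-comm 2 (2 ℕ.* k))
  (Absorbed-resp (≋-trans (⊗-comm (invPoch a′ 4 L) (qPoch (2 ℕ.+ 2 ℕ.* k) 2 L))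
                          (≋-sym (invS-poch-minusOne (1 ℕ.+ 2 ℕ.* k) 2 L)))
    (Absorbed-⊗ˡ (nonNeg-invPoch a′ 4 L) (qPoch-absorbed 1 2 k L)))
  where a′ = 2 ℕ.* (2 ℕ.+ 2 ℕ.* k)

-- The denominator and the infinite sums

⊗-oneMinus-stable : ∀ X {e y m} → VanishesBelow e y → m < e → (X ⊗ (oneS ⊖ y)) m ≡ X m
⊗-oneMinus-stable X {e} {y} {m} y≈0 m<e = begin
  (X ⊗ (oneS ⊖ y)) m   ≡⟨ at (solve 2 (λ x y → x :* (con 1ℤ :- y) := x :- x :* y) ≋-refl X y) m ⟩
  X m ℤ.- (X ⊗ y) m    ≡⟨ cong (ℤ._-_ (X m)) (vanishes-⊗ʳ X y≈0 m m<e) ⟩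
  X m ℤ.- 0ℤ           ≡⟨ ℤ.+-identityʳ (X m) ⟩
  X m                  ∎
  where open ≡-Reasoning

poch-stable : ∀ c a b m d → poch c (suc a) (suc b) (suc m ℕ.+ d) m ≡ poch c (suc a) (suc b) (suc m) m
poch-stable c a b m zero    rewrite ℕ.+-identityʳ m = refl
poch-stable c a b m (suc d) rewrite ℕ.+-suc m d =
  trans (⊗-oneMinus-stable (poch c (suc a) (suc b) (suc m ℕ.+ d)) (·qpow-vanishes c e) m<e)
        (poch-stable c a b m d)
  where
  e = suc a ℕ.+ suc b ℕ.* (suc m ℕ.+ d)
  m<e : m < e
  m<e = ℕ.≤-trans (ℕ.m≤m+n (suc m) d) (ℕ.≤-trans (ℕ.m≤m+n _ (b ℕ.* (suc m ℕ.+ d))) (ℕ.m≤n+m _ (suc a)))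

poch-agree : ∀ c a b {n N} → n < N → AgreeUpTo n (poch∞ c (suc a) (suc b)) (poch c (suc a) (suc b) N)
poch-agree c a b {N = N} n<N m m≤n = begin
  poch c (suc a) (suc b) (suc m) m
    ≡⟨ poch-stable c a b m (N ∸ suc m) ⟨
  poch c (suc a) (suc b) (suc m ℕ.+ (N ∸ suc m)) m
    ≡⟨ cong (λ L → poch c (suc a) (suc b) L m) (ℕ.m+[n∸m]≡n m<N) ⟩
  poch c (suc a) (suc b) N m
    ∎
  where
  open ≡-Reasoning
  m<N = ℕ.<-≤-trans (s≤s m≤n) n<N

D⁻¹-trunc : ℕ → Series
D⁻¹-trunc N = powS (invPoch 2 2 N) 3 ⊗ powS (invPoch 2 4 N) 2

⊘D-agree : ∀ X {n N} → n < N → (X ⊘ D) n ≡ (X ⊗ D⁻¹-trunc N) n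
⊘D-agree X {n} {N} n<N = ⊗-congˡ-≤ n X λ m m≤n → begin
  invS D m
    ≡⟨ invS-agree n D-agree m m≤n ⟩
  invS (powS (poch 1ℤ 2 2 N) 3 ⊗ powS (poch 1ℤ 2 4 N) 2) m
    ≡⟨ at invS-D-trunc m ⟩
  D⁻¹-trunc N m
    ∎
  where
  open ≡-Reasoning
  D-agree : AgreeUpTo n D (powS (poch 1ℤ 2 2 N) 3 ⊗ powS (poch 1ℤ 2 4 N) 2)
  D-agree = ⊗-agree n (powS-agree n (poch-agree 1ℤ 1 1 n<N) 3) (powS-agree n (poch-agree 1ℤ 1 3 n<N) 2)
  poch₀≡1 : ∀ s → poch 1ℤ 2 s N 0 ≡ 1ℤ
  poch₀≡1 s = finProd-constant N _ (λ t → refl)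
  invS-D-trunc : invS (powS (poch 1ℤ 2 2 N) 3 ⊗ powS (poch 1ℤ 2 4 N) 2) ≋ D⁻¹-trunc N
  invS-D-trunc = ≋-trans
    (invS-⊗ (powS-constant {poch 1ℤ 2 2 N} (poch₀≡1 2) 3) (powS-constant {poch 1ℤ 2 4 N} (poch₀≡1 4) 2))
    (⊗-cong (≋-trans (invS-powS (poch₀≡1 2) 3) (powS-cong (invS-poch-one 1 2 N) 3))
            (≋-trans (invS-powS (poch₀≡1 4) 2) (powS-cong (invS-poch-one 1 4 N) 2)))

-- The three copies of 1/(q²; q²)_∞ in 1/D each absorb one factor.
absorbed³⇒⊘D-nonNeg : ∀ {A B C} → Absorbed 2 2 A → Absorbed 2 2 B → Absorbed 2 2 C →
                      NonNegCoeffs (A ⊗ B ⊗ C ⊘ D)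
absorbed³⇒⊘D-nonNeg {A} {B} {C} (absorbed K₁ A-absorbs) (absorbed K₂ B-absorbs) (absorbed K₃ C-absorbs) n =
  subst (0ℤ ℤ.≤_) (sym (⊘D-agree (A ⊗ B ⊗ C) n<N))
    (nonNeg-resp (≋-sym regroup)
      (nonNeg-⊗ (nonNeg-⊗ (nonNeg-⊗ (A-absorbs N K₁≤N) (B-absorbs N K₂≤N)) (C-absorbs N K₃≤N))
                (nonNeg-powS (nonNeg-invPoch 2 4 N) 2)) n)
  where
  N = suc n ⊔ (K₁ ⊔ (K₂ ⊔ K₃))
  n<N : n < N
  n<N = ℕ.m≤m⊔n (suc n) (K₁ ⊔ (K₂ ⊔ K₃))
  K₁≤N : K₁ ≤ N
  K₁≤N = ℕ.≤-trans (ℕ.m≤m⊔n K₁ (K₂ ⊔ K₃)) (ℕ.m≤n⊔m (suc n) _)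
  K₂≤N : K₂ ≤ N
  K₂≤N = ℕ.≤-trans (ℕ.m≤m⊔n K₂ K₃) (ℕ.≤-trans (ℕ.m≤n⊔m K₁ (K₂ ⊔ K₃)) (ℕ.m≤n⊔m (suc n) _))
  K₃≤N : K₃ ≤ N
  K₃≤N = ℕ.≤-trans (ℕ.m≤n⊔m K₂ K₃) (ℕ.≤-trans (ℕ.m≤n⊔m K₁ (K₂ ⊔ K₃)) (ℕ.m≤n⊔m (suc n) _))
  P = invPoch 2 2 N
  Q = invPoch 2 4 N
  regroup : (A ⊗ B ⊗ C) ⊗ D⁻¹-trunc N ≋ ((A ⊗ P) ⊗ (B ⊗ P) ⊗ (C ⊗ P)) ⊗ powS Q 2
  regroup = solve 5 (λ a b c p q → (a :* b :* c) :* ((p :* (p :* (p :* con 1ℤ))) :* (q :* (q :* con 1ℤ)))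
                                   := ((a :* p) :* (b :* p) :* (c :* p)) :* (q :* (q :* con 1ℤ)))
                    ≋-refl A B C P Q

finSum-⊗ : ∀ N (h : ℕ → Series) y → finSum N h ⊗ y ≋ finSum N (λ t → h t ⊗ y)
finSum-⊗ zero    h y = mk≋ (⊗-zeroˡ-at y)
finSum-⊗ (suc N) h y = ≋-trans
  (solve 3 (λ a b y → (a :+ b) :* y := a :* y :+ b :* y) ≋-refl (finSum N h) (h N) y)
  (+-cong (finSum-⊗ N h y) ≋-refl)

finSum-pairs : ∀ N (f : ℕ → Series) → finSum (2 ℕ.* N) f ≋ finSum N (λ j → f (2 ℕ.* j) ⊕ f (suc (2 ℕ.* j)))
finSum-pairs zero    f = ≋-refl
finSum-pairs (suc N) f = subst (λ L → finSum L f ≋ finSum (suc N) pairs) (sym (ℕ.*-suc 2 N)) (≋-trans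
  (solve 3 (λ a b c → (a :+ b) :+ c := a :+ (b :+ c)) ≋-refl
     (finSum (2 ℕ.* N) f) (f (2 ℕ.* N)) (f (suc (2 ℕ.* N))))
  (+-cong (finSum-pairs N f) ≋-refl))
  where pairs = λ j → f (2 ℕ.* j) ⊕ f (suc (2 ℕ.* j))

infSum-cong : ∀ {f f′ : ℕ → Series} → (∀ j → f j ≋ f′ j) → infSum f ≋ infSum f′
infSum-cong f≋f′ = mk≋ λ n → sumTo-cong n (λ j _ → at (f≋f′ j) n)

module _ (f : ℕ → Series) (f-vanishes : ∀ j → VanishesBelow j (f j)) where

  infSum-agree : ∀ {m M} → m < M → infSum f m ≡ finSum M f m
  infSum-agree {m} m<M = trans (sym (finSum-at m f m)) (sym (finSum-stable f-vanishes m<M))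

  infSum-⊗ : ∀ y → infSum f ⊗ y ≋ infSum (λ j → f j ⊗ y)
  infSum-⊗ y = mk≋ λ n → begin
    (infSum f ⊗ y) n                  ≡⟨ ⊗-cong-≤ n {b = y} (λ m m≤n → infSum-agree (s≤s m≤n)) (λ _ _ → refl) ⟩
    (finSum (suc n) f ⊗ y) n          ≡⟨ at (finSum-⊗ (suc n) f y) n ⟩
    finSum (suc n) (λ j → f j ⊗ y) n  ≡⟨ finSum-at n (λ j → f j ⊗ y) n ⟩
    infSum (λ j → f j ⊗ y) n          ∎
    where open ≡-Reasoning

  infSum-pairs : infSum f ≋ infSum (λ j → f (2 ℕ.* j) ⊕ f (suc (2 ℕ.* j)))
  infSum-pairs = mk≋ λ n → begin
    infSum f n                              ≡⟨ infSum-agree (ℕ.m≤m+n (suc n) _) ⟩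
    finSum (2 ℕ.* suc n) f n                ≡⟨ at (finSum-pairs (suc n) f) n ⟩
    finSum (suc n) pairs n                  ≡⟨ finSum-at n pairs n ⟩
    infSum pairs n                          ∎
    where
    open ≡-Reasoning
    pairs = λ j → f (2 ℕ.* j) ⊕ f (suc (2 ℕ.* j))

  infSum-⊘D-nonNeg : (∀ j → NonNegCoeffs (f j ⊘ D)) → NonNegCoeffs (infSum f ⊘ D)
  infSum-⊘D-nonNeg terms≥0 = nonNeg-resp (≋-sym (infSum-⊗ (invS D))) (nonNeg-infSum {λ j → f j ⊘ D} terms≥0)

  pairs-vanish : ∀ j → VanishesBelow j (f (2 ℕ.* j) ⊕ f (suc (2 ℕ.* j)))
  pairs-vanish j m m<j = cong₂ ℤ._+_
    (f-vanishes (2 ℕ.* j) m (ℕ.<-≤-trans m<j (ℕ.m≤n*m j 2)))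
    (f-vanishes (suc (2 ℕ.* j)) m (ℕ.<-≤-trans m<j (ℕ.m≤n⇒m≤1+n (ℕ.m≤n*m j 2))))

infSum-pairs-⊘D-nonNeg : ∀ f (f-vanishes : ∀ j → VanishesBelow j (f j)) →
  (∀ j → NonNegCoeffs ((f (2 ℕ.* j) ⊕ f (suc (2 ℕ.* j))) ⊘ D)) → NonNegCoeffs (infSum f ⊘ D)
infSum-pairs-⊘D-nonNeg f f-vanishes pairs≥0 =
  nonNeg-resp (⊗-congʳ (invS D) (≋-sym (infSum-pairs f f-vanishes)))
  (infSum-⊘D-nonNeg (λ j → f (2 ℕ.* j) ⊕ f (suc (2 ℕ.* j))) (pairs-vanish f f-vanishes) pairs≥0)

-- The four series

T-absorbed : ∀ k j → Absorbed 2 2 (T k j)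
T-absorbed k j = Absorbed-⊗ˡ (nonNeg-qpow _) (invS-poch-minusOne-absorbed k (2 ℕ.* j ℕ.+ 2))

T-vanishes : ∀ k j → VanishesBelow j (T k j)
T-vanishes k j = vanishes-mono j≤E (qpow-⊗-vanishes E (invS (poch -1ℤ (2 ℕ.* k ℕ.+ 2) 2 (2 ℕ.* j ℕ.+ 2))))
  where
  E = 8 ℕ.* k ℕ.* j ℕ.+ 8 ℕ.* k ℕ.+ 4 ℕ.* j ℕ.* j ℕ.+ 6 ℕ.* j ℕ.+ 2
  j≤E : j ≤ E
  j≤E = ℕ.≤-trans (ℕ.m≤n*m j 6)
          (ℕ.≤-trans (ℕ.m≤n+m (6 ℕ.* j) (8 ℕ.* k ℕ.* j ℕ.+ 8 ℕ.* k ℕ.+ 4 ℕ.* j ℕ.* j))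
                     (ℕ.m≤m+n (8 ℕ.* k ℕ.* j ℕ.+ 8 ℕ.* k ℕ.+ 4 ℕ.* j ℕ.* j ℕ.+ 6 ℕ.* j) 2))

g-absorbed : ∀ k i → Absorbed 2 2 (g k (suc i))
g-absorbed k i = Absorbed-⊗ˡ (nonNeg-qpow _) (onePlusQ⁻¹-absorbed (i ℕ.+ k) (ℕ-Solver.solve (i ∷ k ∷ [])))

T-series-⊘D-nonNeg : ∀ k (x y : ℕ → Series) → (∀ j → Absorbed 2 2 (x j)) → (∀ j → Absorbed 2 2 (y j)) →
                     NonNegCoeffs (infSum (λ j → T k j ⊗ x j ⊗ y j) ⊘ D)
T-series-⊘D-nonNeg k x y x-absorbed y-absorbed =
  infSum-⊘D-nonNeg (λ j → T k j ⊗ x j ⊗ y j) (λ j → vanishes-⊗ˡ (y j) (vanishes-⊗ˡ (x j) (T-vanishes k j)))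
    (λ j → absorbed³⇒⊘D-nonNeg (T-absorbed k j) (x-absorbed j) (y-absorbed j))

C1-nonNeg : ∀ k → NonNegCoeffs (C1 k ⊘ D)
C1-nonNeg k = T-series-⊘D-nonNeg k
  (λ j → oneS ⊖ qpow (4 ℕ.* k ℕ.+ 4 ℕ.* j ℕ.+ 4))
  (λ j → finSum (2 ℕ.* j ℕ.+ 1) (λ i → g k (i ℕ.+ 1)))
  (λ j → oneMinusQ²-absorbed _ (2 ℕ.* k ℕ.+ 2 ℕ.* j ℕ.+ 1) (ℕ-Solver.solve (k ∷ j ∷ [])))
  (λ j → Absorbed-finSum (2 ℕ.* j ℕ.+ 1) λ i _ → subst (Absorbed 2 2 ∘ g k) (ℕ.+-comm 1 i) (g-absorbed k i))

C2-nonNeg : ∀ k → NonNegCoeffs (C2 k ⊘ D)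
C2-nonNeg k = T-series-⊘D-nonNeg k
  (λ j → qpow (2 ℕ.* k ℕ.+ 4 ℕ.* j ℕ.+ 4))
  (λ j → finSum (2 ℕ.* j) (λ i → g k (i ℕ.+ 2)))
  (λ j → nonNeg⇒Absorbed (nonNeg-qpow _))
  (λ j → Absorbed-finSum (2 ℕ.* j) λ i _ → subst (Absorbed 2 2 ∘ g k) (ℕ.+-comm 2 i) (g-absorbed k (suc i)))

-- q²/(1 + q^{2+2a}) − q^{2+2s}/(1 + q^{2+2s})
--   = differenceCofactor a s · (1 − q²)(1 − q^{2+2a})(1 − q^{2+2s})
differenceCofactor : ℕ → ℕ → Series
differenceCofactor a s =
  (geometric (2 ℕ.* (2 ℕ.+ 2 ℕ.* a)) ⊗ geometric (2 ℕ.* (2 ℕ.+ 2 ℕ.* s)))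
  ⊗ (qpow 2 ⊗ evenPowers s ⊕ qpow (2 ℕ.+ 2 ℕ.* s) ⊗ (qpow 2 ⊗ evenPowers a))

nonNeg-differenceCofactor : ∀ a s → NonNegCoeffs (differenceCofactor a s)
nonNeg-differenceCofactor a s =
  nonNeg-⊗ (nonNeg-⊗ (nonNeg-geometric (2 ℕ.* (2 ℕ.+ 2 ℕ.* a))) (nonNeg-geometric (2 ℕ.* (2 ℕ.+ 2 ℕ.* s))))
    (nonNeg-⊕ (nonNeg-⊗ (nonNeg-qpow 2) (nonNeg-evenPowers s))
              (nonNeg-⊗ (nonNeg-qpow (2 ℕ.+ 2 ℕ.* s)) (nonNeg-⊗ (nonNeg-qpow 2) (nonNeg-evenPowers a))))

onePlusQ⁻¹-difference : ∀ a s →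
  qpow 2 ⊗ invS (oneS ⊕ qpow (2 ℕ.+ 2 ℕ.* a)) ⊖ qpow (2 ℕ.+ 2 ℕ.* s) ⊗ invS (oneS ⊕ qpow (2 ℕ.+ 2 ℕ.* s))
    ≋ (differenceCofactor a s ⊗ ((oneS ⊖ qpow 2) ⊗ (oneS ⊖ qpow (2 ℕ.+ 2 ℕ.* a))))
      ⊗ (oneS ⊖ qpow (2 ℕ.+ 2 ℕ.* s))
onePlusQ⁻¹-difference a s = begin
    x ⊗ invS (oneS ⊕ Z) ⊖ X ⊗ invS (oneS ⊕ X)
      ≈⟨ +-cong (⊗-congˡ x (invS-onePlusQ (1 ℕ.+ 2 ℕ.* a)))
                (-‿cong (⊗-congˡ X (invS-onePlusQ (1 ℕ.+ 2 ℕ.* s)))) ⟩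
    x ⊗ ((oneS ⊖ Z) ⊗ r′) ⊖ X ⊗ ((oneS ⊖ X) ⊗ t′)
      ≈⟨ solve 5 (λ x z r′ X t′ → x :* ((con 1ℤ :- z) :* r′) :- X :* ((con 1ℤ :- X) :* t′)
                                  := (x :* (con 1ℤ :- z)) :* r′ :- (X :* (con 1ℤ :- X)) :* t′)
           ≋-refl x Z r′ X t′ ⟩
    (x ⊗ (oneS ⊖ Z)) ⊗ r′ ⊖ (X ⊗ (oneS ⊖ X)) ⊗ t′
      ≈⟨ fraction-difference (x ⊗ (oneS ⊖ Z)) (X ⊗ (oneS ⊖ X)) (oneS ⊖ Z ⊗ Z) r′ (oneS ⊖ X ⊗ X) t′
           (geometric-inverse² (1 ℕ.+ 2 ℕ.* a)) (geometric-inverse² (1 ℕ.+ 2 ℕ.* s)) ⟩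
    (r′ ⊗ t′) ⊗ ((x ⊗ (oneS ⊖ Z)) ⊗ (oneS ⊖ X ⊗ X) ⊖ (X ⊗ (oneS ⊖ X)) ⊗ (oneS ⊖ Z ⊗ Z))
      ≈⟨ ⊗-congˡ (r′ ⊗ t′) (solve 3 (λ x X Z →
            (x :* (con 1ℤ :- Z)) :* (con 1ℤ :- X :* X) :- (X :* (con 1ℤ :- X)) :* (con 1ℤ :- Z :* Z)
            := ((con 1ℤ :- Z) :* (con 1ℤ :- X)) :* ((x :- X) :+ X :* (x :- Z))) ≋-refl x X Z) ⟩
    (r′ ⊗ t′) ⊗ (((oneS ⊖ Z) ⊗ (oneS ⊖ X)) ⊗ ((x ⊖ X) ⊕ X ⊗ (x ⊖ Z)))
      ≈⟨ ⊗-congˡ (r′ ⊗ t′) (⊗-congˡ ((oneS ⊖ Z) ⊗ (oneS ⊖ X))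
           (+-cong (qpow²-difference s) (⊗-congˡ X (qpow²-difference a)))) ⟩
    (r′ ⊗ t′) ⊗ (((oneS ⊖ Z) ⊗ (oneS ⊖ X)) ⊗ (x ⊗ ((oneS ⊖ x) ⊗ Gₛ) ⊕ X ⊗ (x ⊗ ((oneS ⊖ x) ⊗ Gₐ))))
      ≈⟨ solve 7 (λ r′ t′ x X Z Gₛ Gₐ →
            (r′ :* t′) :* (((con 1ℤ :- Z) :* (con 1ℤ :- X))
                           :* (x :* ((con 1ℤ :- x) :* Gₛ) :+ X :* (x :* ((con 1ℤ :- x) :* Gₐ))))
            := (((r′ :* t′) :* (x :* Gₛ :+ X :* (x :* Gₐ))) :* ((con 1ℤ :- x) :* (con 1ℤ :- Z)))
               :* (con 1ℤ :- X))
           ≋-refl r′ t′ x X Z Gₛ Gₐ ⟩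
    ((r′ ⊗ t′) ⊗ (x ⊗ Gₛ ⊕ X ⊗ (x ⊗ Gₐ)) ⊗ ((oneS ⊖ x) ⊗ (oneS ⊖ Z))) ⊗ (oneS ⊖ X)
      ∎
  where
  open ≋-Reasoning
  x = qpow 2
  Z = qpow (2 ℕ.+ 2 ℕ.* a)
  X = qpow (2 ℕ.+ 2 ℕ.* s)
  r′ = geometric (2 ℕ.* (2 ℕ.+ 2 ℕ.* a))
  t′ = geometric (2 ℕ.* (2 ℕ.+ 2 ℕ.* s))
  Gₛ = evenPowers s
  Gₐ = evenPowers a

-- This is where k ≥ 1 is needed: 1 − q² and 1 − q^{2k+2} must be distinct factors of (q²; q²)_∞.
oneMinusQ²-pair-absorbed : ∀ k′ → Absorbed 2 2 ((oneS ⊖ qpow 2) ⊗ (oneS ⊖ qpow (2 ℕ.+ 2 ℕ.* suc k′)))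
oneMinusQ²-pair-absorbed k′ = Absorbed-oneMinusQ-⊗ 0
  (subst (λ e → Absorbed 4 2 (oneS ⊖ qpow e)) exponent (oneMinusQ-absorbed 3 2 k′))
  where
  exponent : 4 ℕ.+ 2 ℕ.* k′ ≡ 2 ℕ.+ 2 ℕ.* suc k′
  exponent = ℕ-Solver.solve (k′ ∷ [])

C3-summand : ℕ → ℕ → Series
C3-summand k j = T k j ⊗ qpow (2 ℕ.* k ℕ.+ 4 ℕ.* j ℕ.+ 4)
                       ⊗ (qpow 2 ⊘ (oneS ⊕ qpow (2 ℕ.* k ℕ.+ 2))
                          ⊖ qpow (2 ℕ.* k ℕ.+ 4 ℕ.* j ℕ.+ 4) ⊘ (oneS ⊕ qpow (2 ℕ.* k ℕ.+ 4 ℕ.* j ℕ.+ 4)))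

C3-nonNeg : ∀ k′ → NonNegCoeffs (C3 (suc k′) ⊘ D)
C3-nonNeg k′ = nonNeg-resp (⊗-congʳ (invS D) (infSum-cong (λ j → ≋-sym (summand≋ j))))
  (T-series-⊘D-nonNeg k (λ j → qpow (X j) ⊗ differenceCofactor k (s j) ⊗ pair) (λ j → oneS ⊖ qpow (X j))
    (λ j → Absorbed-⊗ˡ (nonNeg-⊗ (nonNeg-qpow (X j)) (nonNeg-differenceCofactor k (s j)))
                       (oneMinusQ²-pair-absorbed k′))
    (λ j → oneMinusQ²-absorbed (X j) (s j) refl))
  where
  k = suc k′
  s X : ℕ → ℕ
  s j = k ℕ.+ 2 ℕ.* j ℕ.+ 1
  X j = 2 ℕ.+ 2 ℕ.* s j
  pair = (oneS ⊖ qpow 2) ⊗ (oneS ⊖ qpow (2 ℕ.+ 2 ℕ.* k))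
  exponent : ∀ k j → 2 ℕ.* k ℕ.+ 4 ℕ.* j ℕ.+ 4 ≡ 2 ℕ.+ 2 ℕ.* (k ℕ.+ 2 ℕ.* j ℕ.+ 1)
  exponent = ℕ-Solver.solve-∀
  summand≋ : ∀ j → C3-summand k j ≋
                   T k j ⊗ (qpow (X j) ⊗ differenceCofactor k (s j) ⊗ pair) ⊗ (oneS ⊖ qpow (X j))
  summand≋ j = begin
    C3-summand k j
      ≡⟨ cong₂ (λ A X → T k j ⊗ qpow X ⊗ (qpow 2 ⊘ (oneS ⊕ qpow A) ⊖ qpow X ⊘ (oneS ⊕ qpow X)))
               (ℕ.+-comm (2 ℕ.* k) 2) (exponent k j) ⟩
    T k j ⊗ qpow (X j) ⊗ (qpow 2 ⊘ (oneS ⊕ qpow (2 ℕ.+ 2 ℕ.* k)) ⊖ qpow (X j) ⊘ (oneS ⊕ qpow (X j)))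
      ≈⟨ ⊗-congˡ (T k j ⊗ qpow (X j)) (onePlusQ⁻¹-difference k (s j)) ⟩
    T k j ⊗ qpow (X j) ⊗ ((differenceCofactor k (s j) ⊗ pair) ⊗ (oneS ⊖ qpow (X j)))
      ≈⟨ solve 5 (λ t x u p f → t :* x :* ((u :* p) :* f) := t :* (x :* u :* p) :* f) ≋-refl
           (T k j) (qpow (X j)) (differenceCofactor k (s j)) pair (oneS ⊖ qpow (X j)) ⟩
    T k j ⊗ (qpow (X j) ⊗ differenceCofactor k (s j) ⊗ pair) ⊗ (oneS ⊖ qpow (X j))
      ∎
    where open ≋-Reasoning

-1^even : ∀ j → -1ℤ ℤ.^ (2 ℕ.* j) ≡ 1ℤ
-1^even j = trans (sym (ℤ.^-*-assoc -1ℤ 2 j)) (ℤ.^-zeroˡ j)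

C4-coefficient-even : ∀ j → (-1ℤ ℤ.^ (2 ℕ.* j)) ℤ.* + (2 ℕ.* (2 ℕ.* j) ℕ.+ 2) ≡ + (2 ℕ.* (2 ℕ.* j)) ℤ.+ + 2
C4-coefficient-even j = begin
  (-1ℤ ℤ.^ (2 ℕ.* j)) ℤ.* + (2 ℕ.* m ℕ.+ 2)  ≡⟨ cong (ℤ._* + (2 ℕ.* m ℕ.+ 2)) (-1^even j) ⟩
  1ℤ ℤ.* + (2 ℕ.* m ℕ.+ 2)                   ≡⟨ ℤ.*-identityˡ _ ⟩
  + (2 ℕ.* m ℕ.+ 2)                          ≡⟨ ℤ.pos-+ (2 ℕ.* m) 2 ⟩
  + (2 ℕ.* m) ℤ.+ + 2                        ∎
  where
  open ≡-Reasoning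
  m = 2 ℕ.* j

C4-coefficient-odd : ∀ j →
  (-1ℤ ℤ.^ suc (2 ℕ.* j)) ℤ.* + (2 ℕ.* suc (2 ℕ.* j) ℕ.+ 2) ≡ ℤ.- (+ (2 ℕ.* (2 ℕ.* j)) ℤ.+ + 4)
C4-coefficient-odd j = begin
  (-1ℤ ℤ.* (-1ℤ ℤ.^ m)) ℤ.* + n  ≡⟨ cong (λ x → (-1ℤ ℤ.* x) ℤ.* + n) (-1^even j) ⟩
  -1ℤ ℤ.* + n                    ≡⟨ ℤ.-1*i≡-i (+ n) ⟩
  ℤ.- + n                        ≡⟨ cong (λ n → ℤ.- + n) (2[1+m]+2≡2m+4 m) ⟩
  ℤ.- + (2 ℕ.* m ℕ.+ 4)          ≡⟨ cong ℤ.-_ (ℤ.pos-+ (2 ℕ.* m) 4) ⟩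
  ℤ.- (+ (2 ℕ.* m) ℤ.+ + 4)      ∎
  where
  open ≡-Reasoning
  m = 2 ℕ.* j
  n = 2 ℕ.* suc m ℕ.+ 2
  2[1+m]+2≡2m+4 : ∀ m → 2 ℕ.* suc m ℕ.+ 2 ≡ 2 ℕ.* m ℕ.+ 4
  2[1+m]+2≡2m+4 = ℕ-Solver.solve-∀

-- (n + 2)(1 + q^e) − (n + 4) q^{e+w}, regrouped so that every summand is a non-negative multiple of
-- a single factor 1 − q^{2+2t}
pairCofactor : ℕ → ℕ → ℕ → Series
pairCofactor n e w = (cst (+ n) ⊕ cst (+ 2)) ⊗ (oneS ⊖ qpow e ⊗ qpow w) ⊕ cst (+ n) ⊗ qpow e
                     ⊕ (cst (+ 2) ⊗ qpow e) ⊗ (oneS ⊖ qpow w)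

pairCofactor-absorbed : ∀ n e w t u → e ℕ.+ w ≡ 2 ℕ.+ 2 ℕ.* t → w ≡ 2 ℕ.+ 2 ℕ.* u →
                        Absorbed 2 2 (pairCofactor n e w)
pairCofactor-absorbed n e w t u e+w≡ w≡ = Absorbed-⊕ (Absorbed-⊕
    (Absorbed-⊗ˡ (nonNeg-⊕ (nonNeg-cst n) (nonNeg-cst 2))
       (Absorbed-resp (+-cong (≋-refl {oneS}) (-‿cong (≋-sym (qpow-⊗-qpow e w))))
          (oneMinusQ²-absorbed (e ℕ.+ w) t e+w≡)))
    (nonNeg⇒Absorbed (nonNeg-⊗ (nonNeg-cst n) (nonNeg-qpow e))))
  (Absorbed-⊗ˡ (nonNeg-⊗ (nonNeg-cst 2) (nonNeg-qpow e)) (oneMinusQ²-absorbed w u w≡))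

C4-summand : ℕ → ℕ → Series
C4-summand k n = ((-1ℤ ℤ.^ n) ℤ.* (+ (2 ℕ.* n ℕ.+ 2)))
                   · qpow (4 ℕ.* k ℕ.* n ℕ.+ 2 ℕ.* k ℕ.+ n ℕ.* n ℕ.+ n)
                 ⊘ poch -1ℤ (2 ℕ.* k ℕ.+ 2) 2 n

C4-summand-vanishes : ∀ k n → VanishesBelow n (C4-summand k n)
C4-summand-vanishes k n = vanishes-⊗ˡ (invS (poch -1ℤ (2 ℕ.* k ℕ.+ 2) 2 n))
  (vanishes-mono (ℕ.m≤n+m n (4 ℕ.* k ℕ.* n ℕ.+ 2 ℕ.* k ℕ.+ n ℕ.* n))
                 (·qpow-vanishes ((-1ℤ ℤ.^ n) ℤ.* (+ (2 ℕ.* n ℕ.+ 2)))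
                                 (4 ℕ.* k ℕ.* n ℕ.+ 2 ℕ.* k ℕ.+ n ℕ.* n ℕ.+ n)))

C4-pair-nonNeg : ∀ k′ j →
  NonNegCoeffs ((C4-summand (suc k′) (2 ℕ.* j) ⊕ C4-summand (suc k′) (suc (2 ℕ.* j))) ⊘ D)
C4-pair-nonNeg k′ j = nonNeg-resp (⊗-congʳ (invS D) (≋-sym pair≋))
  (absorbed³⇒⊘D-nonNeg (Absorbed-⊗ˡ (nonNeg-qpow B) (invS-poch-minusOne-absorbed k (suc m)))
                       (pairCofactor-absorbed (2 ℕ.* m) e w (2 ℕ.* k ℕ.+ m) k′ (e+w≡ k j) (ℕ.*-suc 2 k′))
                       (nonNeg⇒Absorbed nonNeg-oneS))
  where
  k = suc k′
  m = 2 ℕ.* j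
  a = 2 ℕ.* k ℕ.+ 2
  e = a ℕ.+ 2 ℕ.* m
  w = 2 ℕ.* k
  B = 4 ℕ.* k ℕ.* m ℕ.+ 2 ℕ.* k ℕ.+ m ℕ.* m ℕ.+ m
  B′ = 4 ℕ.* k ℕ.* suc m ℕ.+ 2 ℕ.* k ℕ.+ suc m ℕ.* suc m ℕ.+ suc m
  V = invS (poch -1ℤ a 2 (suc m))
  μ = cst (+ (2 ℕ.* m))

  e+w≡ : ∀ k j → (2 ℕ.* k ℕ.+ 2) ℕ.+ 2 ℕ.* (2 ℕ.* j) ℕ.+ 2 ℕ.* k ≡ 2 ℕ.+ 2 ℕ.* (2 ℕ.* k ℕ.+ 2 ℕ.* j)
  e+w≡ = ℕ-Solver.solve-∀
  B′≡ : ∀ k m → 4 ℕ.* k ℕ.* suc m ℕ.+ 2 ℕ.* k ℕ.+ suc m ℕ.* suc m ℕ.+ suc m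
              ≡ (4 ℕ.* k ℕ.* m ℕ.+ 2 ℕ.* k ℕ.+ m ℕ.* m ℕ.+ m) ℕ.+ ((2 ℕ.* k ℕ.+ 2) ℕ.+ 2 ℕ.* m ℕ.+ 2 ℕ.* k)
  B′≡ = ℕ-Solver.solve-∀

  B′≋ : qpow B′ ≋ qpow B ⊗ (qpow e ⊗ qpow w)
  B′≋ = ≋-sym (≋-trans (⊗-congˡ (qpow B) (qpow-⊗-qpow e w))
                (≋-trans (qpow-⊗-qpow B (e ℕ.+ w)) (≡⇒≋ (cong qpow (sym (B′≡ k m))))))

  W≋ : invS (poch -1ℤ a 2 m) ≋ V ⊗ (oneS ⊕ qpow e)
  W≋ = ≋-sym (≋-trans (⊗-congˡ V (≋-sym (⊖-1·≋⊕ oneS (qpow e))))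
    (invS-⊗-cancelʳ {poch -1ℤ a 2 m} {oneS ⊖ -1ℤ · qpow e} (finProd-constant m _ (λ t → refl)) refl))

  pair≋ : C4-summand k m ⊕ C4-summand k (suc m) ≋ (qpow B ⊗ V) ⊗ pairCofactor (2 ℕ.* m) e w ⊗ oneS
  pair≋ = begin
    C4-summand k m ⊕ C4-summand k (suc m)
      ≈⟨ +-cong (⊗-congʳ (invS (poch -1ℤ a 2 m)) (·≋cst-⊗ _ (qpow B))) (⊗-congʳ V (·≋cst-⊗ _ (qpow B′))) ⟩
    (cst _ ⊗ qpow B) ⊗ invS (poch -1ℤ a 2 m) ⊕ (cst _ ⊗ qpow B′) ⊗ V
      ≈⟨ +-cong (⊗-cong (⊗-congʳ (qpow B) (≋-trans (≡⇒≋ (cong cst (C4-coefficient-even j))) (mk≋ cst-+))) W≋)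
                (⊗-congʳ V (⊗-cong (≋-trans (≡⇒≋ (cong cst (C4-coefficient-odd j))) (mk≋ cst-neg+)) B′≋)) ⟩
    ((μ ⊕ cst (+ 2)) ⊗ qpow B) ⊗ (V ⊗ (oneS ⊕ qpow e))
      ⊕ (negS (μ ⊕ cst (+ 4)) ⊗ (qpow B ⊗ (qpow e ⊗ qpow w))) ⊗ V
      ≈⟨ solve 5 (λ μ b v x y →
            ((μ :+ con (+ 2)) :* b) :* (v :* (con 1ℤ :+ x)) :+ (:- (μ :+ con (+ 4)) :* (b :* (x :* y))) :* v
            := (b :* v) :* ((μ :+ con (+ 2)) :* (con 1ℤ :- x :* y) :+ μ :* x
                            :+ (con (+ 2) :* x) :* (con 1ℤ :- y)) :* con 1ℤ)
           ≋-refl μ (qpow B) V (qpow e) (qpow w) ⟩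
    (qpow B ⊗ V) ⊗ pairCofactor (2 ℕ.* m) e w ⊗ oneS
      ∎
    where
    open ≋-Reasoning
    cst-+ : ∀ n → cst (+ (2 ℕ.* m) ℤ.+ + 2) n ≡ (μ ⊕ cst (+ 2)) n
    cst-+ zero    = refl
    cst-+ (suc n) = refl
    cst-neg+ : ∀ n → cst (ℤ.- (+ (2 ℕ.* m) ℤ.+ + 4)) n ≡ negS (μ ⊕ cst (+ 4)) n
    cst-neg+ zero    = refl
    cst-neg+ (suc n) = refl

C4-nonNeg : ∀ k′ → NonNegCoeffs (C4 (suc k′) ⊘ D)
C4-nonNeg k′ = infSum-pairs-⊘D-nonNeg (C4-summand (suc k′)) (C4-summand-vanishes (suc k′)) (C4-pair-nonNeg k′)

lemma4p4 : ∀ (k : ℕ) → 1 ≤ k →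
    NonNegCoeffs (C1 k ⊘ D) × NonNegCoeffs (C2 k ⊘ D) × NonNegCoeffs (C3 k ⊘ D) × NonNegCoeffs (C4 k ⊘ D)
lemma4p4 zero    ()
lemma4p4 (suc k′) _ = C1-nonNeg k , C2-nonNeg k , C3-nonNeg k′ , C4-nonNeg k′
  where k = suc k′
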